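{- Let $\pi\in\mathfrak{B}_n$. In the grid $P_\pi$: (a) each $0_h^+$-path (resp. $1_h^+$-path) goes from the left boundary to the right boundary along horizontal grid lines, except that it takes a southeast (resp. northeast) diagonal step across a positive square when it encounters one; (b) each $0_v^+$-path (resp. $1_v^+$-path) goes from the top boundary to the bottom boundary along vertical grid lines, except that it takes a southeast (resp. southwest) step across a positive square when it encounters one; (c) each $0_h^-$-path (resp. $1_h^-$-path) goes from the left boundary to the right boundary along horizontal grid lines, except that it takes a northeast (resp. southeast) step across a negative square when it encounters one; (d) each $0_v^-$-path (resp. $1_v^-$-path) goes from the top boundary to the bottom boundary along vertical grid lines, except that it takes a southwest (resp. southeast) step across a negative square when it encounters one.
   Context: $\mathfrak{B}_n$ is the set of signed permutations $\pi=\pi_1\cdots\pi_n$ ($\pi_i\in\{\pm1,\dots,\pm n\}$, $|\pi_1|,\dots,|\pi_n|$ a permutation of $[n]$), $\pi_0=0$, inverse given by $\pi^{ -1}_{|\pi_i|}=\operatorname{sgn}(\pi_i)\,i$. Natural order: $\operatorname{des}^B(\pi)=|\{i\in\{0,\dots,n-1\}:\pi_i>\pi_{i+1}\}|$, $\operatorname{ides}^B(\pi)=\operatorname{des}^B(\pi^{ -1})$. The grid $P_\pi$ is an $n\times n$ array of squares (rows from top, columns from left); $\langle i,j\rangle$ is the square in row $i$, column $j$; $\langle i,|\pi_i|\rangle$ is a positive square if $\pi_i>0$, negative if $\pi_i<0$. Grid point $(i,j)$ ($1\le i,j\le n+1$) is the intersection of the $i$-th horizontal and $j$-th vertical grid lines.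 For $i,j\in[n+1]$, $\varphi_{(i,j)}(\pi)$ is the $\sigma\in\mathfrak{B}_{n+1}$ with $\sigma_i=j$, $\sigma_k=s(\pi_k)$ for $k<i$, $\sigma_k=s(\pi_{k-1})$ for $k>i$, where $s(x)=x$ if $|x|<j$, $s(x)=x+1$ if $x\ge j$, $s(x)=x-1$ if $x\le-j$ (insertion of a positive square at grid point $(i,j)$); $\overline{\varphi}_{(i,j)}(\pi)$ is the same with $\sigma_i=-j$. Define $d^+(i,j)=(d_h^+(i,j),d_v^+(i,j))=\big(\operatorname{des}^B(\varphi_{(i,j)}(\pi))-\operatorname{des}^B(\pi),\ \operatorname{ides}^B(\varphi_{(i,j)}(\pi))-\operatorname{ides}^B(\pi)\big)$ and $d^-(i,j)=(d_h^-(i,j),d_v^-(i,j))$ the same with $\overline{\varphi}_{(i,j)}$. Paths: for $p\in\{0,1\}$, the $p_h^+$-paths (resp. $p_h^-$-paths) are obtained by connecting grid points of $d_h^+$-type (resp. $d_h^-$-type) $p$ only along horizontal grid lines, and then connecting the resulting segments that do not span a full grid line by diagonal lines only if they touch the same filled square. For $q\in\{0,1\}$, the $q_v^+$-paths (resp. $q_v^-$-paths) are obtained analogously by connecting grid points of $d_v^+$-type (resp. $d_v^-$-type) $q$ only along vertical grid lines, then connecting the non-full segments by diagonal lines only if they touch the same filled square. -}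

module Defs where

open import Data.Bool using (Bool; true; false; if_then_else_; not)
open import Data.Nat as ℕ using (ℕ; zero; suc; _≤_; _∸_; _≡ᵇ_)
open import Data.Integer as ℤ using (ℤ; +_; -_; _≤ᵇ_; _⊖_; ∣_∣; 0ℤ; 1ℤ)
open import Data.List using (List; []; _∷_; map; upTo; take; drop; _++_; length)
open import Data.List.Relation.Binary.Permutation.Propositional using (_↭_)
open import Data.Product using (_×_; _,_; ∃)
open import Data.Sum using (_⊎_)
open import Relation.Binary.PropositionalEquality using (_≡_)
open import Relation.Nullary using (¬_)

-- Signed permutations in one-line notation  π = π₁ ⋯ πₙ  (a list of integers).

Word : Set
Word = List ℤ

IsSignedPerm : ℕ → Word → Set
IsSignedPerm n π = map ∣_∣ π ↭ map suc (upTo n)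

-- 1-indexed entry πᵢ (0 outside 1 ≤ i ≤ length π; note π₀ = 0).
entry : Word → ℕ → ℤ
entry []       _             = 0ℤ
entry (x ∷ xs) zero          = 0ℤ
entry (x ∷ xs) (suc zero)    = x
entry (x ∷ xs) (suc (suc i)) = entry xs (suc i)

_>ᵇ_ : ℤ → ℤ → Bool
x >ᵇ y = not (x ≤ᵇ y)

desFrom : ℤ → Word → ℕ
desFrom prev []       = 0
desFrom prev (x ∷ xs) = (if prev >ᵇ x then 1 else 0) ℕ.+ desFrom x xs

desB : Word → ℕ
desB π = desFrom 0ℤ π

signTimes : ℤ → ℕ → ℤ
signTimes x pos = if x ≤ᵇ - 1ℤ then - (+ pos) else + pos

invAt : ℕ → ℕ → Word → ℤ
invAt k pos []       = 0ℤ
invAt k pos (x ∷ xs) = if ∣ x ∣ ≡ᵇ k then signTimes x pos else invAt k (suc pos) xs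

-- π⁻¹ with π⁻¹_{|πᵢ|} = sgn(πᵢ) i
invB : Word → Word
invB π = map (λ k → invAt (suc k) 1 π) (upTo (length π))

idesB : Word → ℕ
idesB π = desB (invB π)

shift : ℕ → ℤ → ℤ
shift j x =
  if suc ∣ x ∣ ℕ.≤ᵇ j then x
  else (if + j ≤ᵇ x then x ℤ.+ 1ℤ else x ℤ.- 1ℤ)

-- insert value v so that it becomes the i-th entry (1-indexed)
insertAt : ℕ → ℤ → Word → Word
insertAt i v w = take (i ∸ 1) w ++ (v ∷ drop (i ∸ 1) w)

φ : ℕ → ℕ → Word → Word
φ i j π = insertAt i (+ j) (map (shift j) π)

φ̄ : ℕ → ℕ → Word → Word
φ̄ i j π = insertAt i (- (+ j)) (map (shift j) π)

data InsSign : Set where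
  plus minus : InsSign

data Orient : Set where
  horiz vert : Orient

insertion : InsSign → ℕ → ℕ → Word → Word
insertion plus  = φ
insertion minus = φ̄

stat : Orient → Word → ℕ
stat horiz = desB
stat vert  = idesB

d : Word → InsSign → Orient → ℕ → ℕ → ℤ
d π s o i j = stat o (insertion s i j π) ⊖ stat o π

Point : Set
Point = ℕ × ℕ           -- grid point (i , j): row line i, column line j

TypePt : ℕ → Word → InsSign → Orient → ℕ → Point → Set
TypePt n π s o p (i , j) =
  (1 ≤ i × i ≤ suc n) × (1 ≤ j × j ≤ suc n) × d π s o i j ≡ + p

PosSq : Word → ℕ → ℕ → Set
PosSq π r c = 1 ≤ c × entry π r ≡ + c

NegSq : Word → ℕ → ℕ → Set
NegSq π r c = 1 ≤ c × entry π r ≡ - (+ c)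

FilledSq : Word → ℕ → ℕ → Set
FilledSq π r c = PosSq π r c ⊎ NegSq π r c

-- Coordinates relative to an orientation: L = index of the grid line the path
-- runs along, k = position along that line.
--   horizontal: (L , k) ↦ (row L , col k);  vertical: (L , k) ↦ (row k , col L).
pt : Orient → ℕ → ℕ → Point
pt horiz L k = (L , k)
pt vert  L k = (k , L)

along : Orient → Point → ℕ
along horiz (i , j) = j
along vert  (i , j) = i

-- the square with "top-left" corner pt o L k, given as (row , col)
sqRow sqCol : Orient → ℕ → ℕ → ℕ
sqRow horiz L k = L
sqRow vert  L k = k
sqCol horiz L k = k
sqCol vert  L k = L

-- Edges are directed in the direction of
-- increasing position along the lines (left→right, resp. top→bottom).

module PathConstruction (n : ℕ) (π : Word) (o : Orient) (T : Point → Set) where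

  InT : ℕ → ℕ → Set
  InT L k = T (pt o L k)

  IsSegment : ℕ → ℕ → ℕ → Set
  IsSegment L l r =
    1 ≤ l × l ≤ r × r ≤ suc n
    × (∀ k → l ≤ k → k ≤ r → InT L k)
    × (l ≡ 1 ⊎ ¬ InT L (l ∸ 1))
    × (r ≡ suc n ⊎ ¬ InT L (suc r))

  NonFull : ℕ → ℕ → Set
  NonFull l r = ¬ (l ≡ 1 × r ≡ suc n)

  SegFar : ℕ → ℕ → Set
  SegFar L k = ∃ λ l → IsSegment L l k × NonFull l k

  SegNear : ℕ → ℕ → Set
  SegNear L k = ∃ λ r → IsSegment L k r × NonFull k r

  FilledAt : ℕ → ℕ → Set
  FilledAt L k = FilledSq π (sqRow o L k) (sqCol o L k)

  data Edge : Point → Point → Set where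
    straight : ∀ L k → 1 ≤ L → L ≤ suc n → InT L k → InT L (suc k) →
               Edge (pt o L k) (pt o L (suc k))
    diagDown : ∀ L k → SegFar L k → SegNear (suc L) (suc k) → FilledAt L k →
               Edge (pt o L k) (pt o (suc L) (suc k))
    diagUp   : ∀ L k → SegFar (suc L) k → SegNear L (suc k) → FilledAt L k →
               Edge (pt o (suc L) k) (pt o L (suc k))

data Dir : Set where
  down up : Dir
-- horizontal: down = southeast, up = northeast
-- vertical:   down = southeast, up = southwest

module _ (o : Orient) (Sq : ℕ → ℕ → Set) where

  SqAt : ℕ → ℕ → Set
  SqAt L k = Sq (sqRow o L k) (sqCol o L k)

  data Step : Dir → Point → Point → Set where
    diagD : ∀ L k → SqAt L k → Step down (pt o L k) (pt o (suc L) (suc k))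
    strD  : ∀ L k → ¬ SqAt L k → Step down (pt o L k) (pt o L (suc k))
    diagU : ∀ L k → SqAt L k → Step up (pt o (suc L) k) (pt o L (suc k))
    strU  : ∀ L k → (∀ L′ → L ≡ suc L′ → ¬ SqAt L′ k) →
            Step up (pt o L k) (pt o L (suc k))

-- "Each p^s_o-path goes from the near boundary (left / top) to the far
-- boundary (right / bottom) along grid lines of orientation o, except that it
-- takes a diagonal step in direction dir across each square satisfying Sq it
-- encounters":  every path-edge is such a step, every type-p point has exactly
-- one successor (unless on the far boundary) and exactly one predecessor
-- (unless on the near boundary).
record PathsHaveShape (n : ℕ) (π : Word) (s : InsSign) (o : Orient) (p : ℕ)
                      (dir : Dir) (Sq : ℕ → ℕ → Set) : Set where
  T = TypePt n π s o p
  open PathConstruction n π o T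
  field
    edgeIsStep  : ∀ u v → Edge u v → Step o Sq dir u v
    successor   : ∀ u → T u → along o u ≤ n → ∃ λ v → Edge u v
    predecessor : ∀ v → T v → 2 ≤ along o v → ∃ λ u → Edge u v
    noSplit     : ∀ u v v′ → Edge u v → Edge u v′ → v ≡ v′
    noMerge     : ∀ u u′ v → Edge u v → Edge u′ v → u ≡ u′

-- Inserting ±j at position L of π changes desᴮ only through the comparisons of ±j
-- with its new neighbours a = π_{L-1} and b = π_L (reading π_{n+1} as n + 1), so the
-- type of the grid point (L , k) is a function of how ±k compares with a and b.
-- Moving from column k to k + 1, this comparison changes only when a or b equals ±k,
-- i.e. at a filled square of the inserted sign just above or below the line.  Such a
-- square ends a run of type-p points on one of its two lines and starts one on the
-- other, the sign of the change fixing which, so the paths cross it diagonally in the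
-- stated direction and run straight elsewhere; in particular every type-p point has
-- exactly one successor and one predecessor.  Since idesᴮ π = desᴮ π⁻¹ and inversion
-- turns insertion at (i , j) into insertion at (j , i), the vertical paths of π are
-- the horizontal paths of π⁻¹ in the transposed grid.

module Submission where

open import Defs
open import Data.Bool using (Bool; true; false; if_then_else_; not; T)
open import Data.Bool.Properties using (T-≡)
open import Data.Nat as ℕ using (ℕ; zero; suc; _≤_; _<_; _∸_; z≤n; s≤s; s≤s⁻¹; _≡ᵇ_)
import Data.Nat.Properties as ℕP
open import Data.Integer as ℤ using (ℤ; +_; -[1+_]; -_; 0ℤ; _⊖_; ∣_∣)
import Data.Integer.Properties as ℤP
open import Data.List using (List; []; _∷_; map; take; drop; _++_; length; upTo; applyUpTo)
open import Data.List.Properties using (length-map; length-upTo; map-applyUpTo)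
open import Data.List.Membership.Propositional using (_∈_)
open import Data.List.Membership.Propositional.Properties using (∈-map⁺; ∈-map⁻; ∈-upTo⁺; ∈-upTo⁻)
open import Data.List.Relation.Binary.Permutation.Propositional using (↭-sym; ↭⇒↭ₛ)
open import Data.List.Relation.Binary.Permutation.Propositional.Properties using (↭-length; ∈-resp-↭)
open import Data.List.Relation.Unary.All using (All; _∷_)
open import Data.List.Relation.Unary.Any using (here; there)
open import Data.List.Relation.Unary.Unique.Propositional using (Unique; _∷_)
import Data.List.Relation.Unary.Unique.Propositional.Properties as UniqueP
open import Data.Product using (_×_; _,_; proj₁; proj₂; ∃)
open import Data.Sum using (_⊎_; inj₁; inj₂)
open import Data.Empty using (⊥; ⊥-elim)
open import Function using (_∘_; id; _⇔_; mk⇔; Equivalence)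
open import Relation.Nullary using (¬_; Dec; yes; no)
open import Relation.Nullary.Decidable using (_×-dec_; map′)
open import Relation.Binary.Definitions using (tri<; tri≈; tri>)
open import Relation.Binary.PropositionalEquality
open import Data.List.Relation.Binary.Permutation.Setoid.Properties (setoid ℕ) using (Unique-resp-↭)

𝟙 : Bool → ℕ
𝟙 b = if b then 1 else 0

≤⇒≤ᵇ≡true : ∀ {m n} → m ≤ n → (m ℕ.≤ᵇ n) ≡ true
≤⇒≤ᵇ≡true = Equivalence.to T-≡ ∘ ℕP.≤⇒≤ᵇ

¬T⇒≡false : ∀ {b} → ¬ T b → b ≡ false
¬T⇒≡false {false} _  = refl
¬T⇒≡false {true}  ¬t = ⊥-elim (¬t _)

>⇒≤ᵇ≡false : ∀ {m n} → n < m → (m ℕ.≤ᵇ n) ≡ false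
>⇒≤ᵇ≡false {m} {n} n<m = ¬T⇒≡false (ℕP.<⇒≱ n<m ∘ ℕP.≤ᵇ⇒≤ m n)

≤ᵇ-cong : ∀ {m n m′ n′} → (m ≤ n → m′ ≤ n′) → (n < m → n′ < m′) → (m ℕ.≤ᵇ n) ≡ (m′ ℕ.≤ᵇ n′)
≤ᵇ-cong {m} {n} f g with ℕP.≤-<-connex m n
... | inj₁ p rewrite ≤⇒≤ᵇ≡true p | ≤⇒≤ᵇ≡true (f p) = refl
... | inj₂ p rewrite >⇒≤ᵇ≡false p | >⇒≤ᵇ≡false (g p) = refl

shift-+ : ∀ j m → (m < j × shift j (+ m) ≡ + m) ⊎ (j ≤ m × shift j (+ m) ≡ + suc m)
shift-+ j m with ℕP.<-≤-connex m j
... | inj₁ m<j rewrite ≤⇒≤ᵇ≡true m<j = inj₁ (m<j , refl)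
... | inj₂ j≤m rewrite >⇒≤ᵇ≡false (s≤s j≤m) | ≤⇒≤ᵇ≡true j≤m = inj₂ (j≤m , cong +_ (ℕP.+-comm m 1))

shift-− : ∀ j m → (suc m < j × shift j -[1+ m ] ≡ -[1+ m ]) ⊎ (j ≤ suc m × shift j -[1+ m ] ≡ -[1+ suc m ])
shift-− j m with ℕP.<-≤-connex (suc m) j
... | inj₁ m<j rewrite ≤⇒≤ᵇ≡true m<j = inj₁ (m<j , refl)
... | inj₂ j≤m rewrite >⇒≤ᵇ≡false (s≤s j≤m) = inj₂ (j≤m , cong (λ z → -[1+ suc z ]) (ℕP.+-identityʳ m))

shift-≤ᵇ : ∀ j x y → (shift j x ℤ.≤ᵇ shift j y) ≡ (x ℤ.≤ᵇ y)
shift-≤ᵇ j (+ m) (+ n) with shift-+ j m | shift-+ j n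
... | inj₁ (_ , e) | inj₁ (_ , e′) rewrite e | e′ = refl
... | inj₁ (m<j , e) | inj₂ (j≤n , e′) rewrite e | e′ =
  ≤ᵇ-cong (λ _ → ℕP.<⇒≤ (ℕP.<-≤-trans m<j j≤n))
          (λ p → ⊥-elim (ℕP.<-asym (ℕP.<-≤-trans m<j j≤n) (ℕP.<-trans (ℕP.n<1+n n) p)))
... | inj₂ (j≤m , e) | inj₁ (n<j , e′) rewrite e | e′ =
  ≤ᵇ-cong (ℕP.≤-trans (ℕP.n≤1+n m)) (λ _ → ℕP.<-≤-trans n<j j≤m)
... | inj₂ (_ , e) | inj₂ (_ , e′) rewrite e | e′ = ≤ᵇ-cong {suc m} {suc n} {m} {n} s≤s⁻¹ s≤s⁻¹
shift-≤ᵇ j (+ m) -[1+ n ] with shift-+ j m | shift-− j n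
... | inj₁ (_ , e) | inj₁ (_ , e′) rewrite e | e′ = refl
... | inj₁ (_ , e) | inj₂ (_ , e′) rewrite e | e′ = refl
... | inj₂ (_ , e) | inj₁ (_ , e′) rewrite e | e′ = refl
... | inj₂ (_ , e) | inj₂ (_ , e′) rewrite e | e′ = refl
shift-≤ᵇ j -[1+ m ] (+ n) with shift-− j m | shift-+ j n
... | inj₁ (_ , e) | inj₁ (_ , e′) rewrite e | e′ = refl
... | inj₁ (_ , e) | inj₂ (_ , e′) rewrite e | e′ = refl
... | inj₂ (_ , e) | inj₁ (_ , e′) rewrite e | e′ = refl
... | inj₂ (_ , e) | inj₂ (_ , e′) rewrite e | e′ = refl
shift-≤ᵇ j -[1+ m ] -[1+ n ] with shift-− j m | shift-− j n
... | inj₁ (_ , e) | inj₁ (_ , e′) rewrite e | e′ = refl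
... | inj₁ (m<j , e) | inj₂ (j≤n , e′) rewrite e | e′ =
  ≤ᵇ-cong (ℕP.≤-trans (ℕP.n≤1+n n)) (λ _ → s≤s⁻¹ (ℕP.<-≤-trans m<j j≤n))
... | inj₂ (j≤m , e) | inj₁ (n<j , e′) rewrite e | e′ =
  ≤ᵇ-cong (λ _ → ℕP.<⇒≤ (s≤s⁻¹ (ℕP.<-≤-trans n<j j≤m))) (ℕP.<-trans (ℕP.n<1+n m))
... | inj₂ (_ , e) | inj₂ (_ , e′) rewrite e | e′ = ≤ᵇ-cong {suc n} {suc m} {n} {m} s≤s⁻¹ s≤s⁻¹

shift->ᵇ : ∀ j x y → (shift j x >ᵇ shift j y) ≡ (x >ᵇ y)
shift->ᵇ j x y = cong not (shift-≤ᵇ j x y)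

shift>ᵇ[+j] : ∀ j′ x → (shift (suc j′) x >ᵇ (+ suc j′)) ≡ (+ suc j′ ℤ.≤ᵇ x)
shift>ᵇ[+j] j′ (+ m) with shift-+ (suc j′) m
... | inj₁ (m<j , e) rewrite e | ≤⇒≤ᵇ≡true (ℕP.<⇒≤ m<j) | >⇒≤ᵇ≡false m<j = refl
... | inj₂ (j≤m , e) rewrite e | >⇒≤ᵇ≡false (s≤s j≤m) | ≤⇒≤ᵇ≡true j≤m = refl
shift>ᵇ[+j] j′ -[1+ m ] with shift-− (suc j′) m
... | inj₁ (_ , e) rewrite e = refl
... | inj₂ (_ , e) rewrite e = refl

[+j]>ᵇshift : ∀ j′ x → ((+ suc j′) >ᵇ shift (suc j′) x) ≡ not (+ suc j′ ℤ.≤ᵇ x)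
[+j]>ᵇshift j′ (+ m) with shift-+ (suc j′) m
... | inj₁ (m<j , e) rewrite e = refl
... | inj₂ (j≤m , e) rewrite e | ≤⇒≤ᵇ≡true j≤m | ≤⇒≤ᵇ≡true (ℕP.m≤n⇒m≤1+n j≤m) = refl
[+j]>ᵇshift j′ -[1+ m ] with shift-− (suc j′) m
... | inj₁ (_ , e) rewrite e = refl
... | inj₂ (_ , e) rewrite e = refl

shift>ᵇ[-j] : ∀ j′ x → (shift (suc j′) x >ᵇ (- (+ suc j′))) ≡ not (x ℤ.≤ᵇ - (+ suc j′))
shift>ᵇ[-j] j′ (+ m) with shift-+ (suc j′) m
... | inj₁ (m<j , e) rewrite e = refl
... | inj₂ (j≤m , e) rewrite e = refl
shift>ᵇ[-j] j′ -[1+ m ] with shift-− (suc j′) m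
... | inj₁ (_ , e) rewrite e = refl
... | inj₂ (s≤s j≤m , e) rewrite e | ≤⇒≤ᵇ≡true j≤m | ≤⇒≤ᵇ≡true (ℕP.m≤n⇒m≤1+n j≤m) = refl

[-j]>ᵇshift : ∀ j′ x → ((- (+ suc j′)) >ᵇ shift (suc j′) x) ≡ (x ℤ.≤ᵇ - (+ suc j′))
[-j]>ᵇshift j′ (+ m) with shift-+ (suc j′) m
... | inj₁ (m<j , e) rewrite e = refl
... | inj₂ (j≤m , e) rewrite e = refl
[-j]>ᵇshift j′ -[1+ m ] with shift-− (suc j′) m
... | inj₁ (s≤s m<j , e) rewrite e | ≤⇒≤ᵇ≡true (ℕP.<⇒≤ m<j) | >⇒≤ᵇ≡false m<j = refl
... | inj₂ (s≤s j≤m , e) rewrite e | ≤⇒≤ᵇ≡true j≤m | >⇒≤ᵇ≡false (s≤s j≤m) = refl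

-- Descents created by an insertion

-- The m-th entry of p ∷ w, counting p as the 0-th.
entryFrom : ℤ → Word → ℕ → ℤ
entryFrom p w        zero    = p
entryFrom p []       (suc m) = p
entryFrom p (x ∷ xs) (suc m) = entryFrom x xs m

desFrom-insert : ∀ p w m v → suc m ≤ length w →
  desFrom p (take m w ++ v ∷ drop m w) ℕ.+ 𝟙 (entryFrom p w m >ᵇ entryFrom p w (suc m))
  ≡ desFrom p w ℕ.+ (𝟙 (entryFrom p w m >ᵇ v) ℕ.+ 𝟙 (v >ᵇ entryFrom p w (suc m)))
desFrom-insert p (x ∷ xs) zero v _ =
  solve 4 (λ A B D P → (A :+ (B :+ D)) :+ P := (P :+ D) :+ (A :+ B)) refl
    (𝟙 (p >ᵇ v)) (𝟙 (v >ᵇ x)) (desFrom x xs) (𝟙 (p >ᵇ x))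
  where open import Data.Nat.Solver using (module +-*-Solver)
        open +-*-Solver
desFrom-insert p (x ∷ xs) (suc m) v (s≤s h) =
  trans (ℕP.+-assoc (𝟙 (p >ᵇ x)) _ _)
    (trans (cong (𝟙 (p >ᵇ x) ℕ.+_) (desFrom-insert x xs m v h)) (sym (ℕP.+-assoc (𝟙 (p >ᵇ x)) _ _)))

desFrom-append : ∀ p w v → desFrom p (take (length w) w ++ v ∷ drop (length w) w)
  ≡ desFrom p w ℕ.+ 𝟙 (entryFrom p w (length w) >ᵇ v)
desFrom-append p []       v = ℕP.+-identityʳ _
desFrom-append p (x ∷ xs) v =
  trans (cong (𝟙 (p >ᵇ x) ℕ.+_) (desFrom-append x xs v)) (sym (ℕP.+-assoc (𝟙 (p >ᵇ x)) _ _))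

desFrom-map : ∀ (f : ℤ → ℤ) → (∀ x y → (f x >ᵇ f y) ≡ (x >ᵇ y)) →
  ∀ p w → desFrom (f p) (map f w) ≡ desFrom p w
desFrom-map f f-mono p []       = refl
desFrom-map f f-mono p (x ∷ xs) rewrite f-mono p x = cong (𝟙 (p >ᵇ x) ℕ.+_) (desFrom-map f f-mono x xs)

entryFrom-map : ∀ (f : ℤ → ℤ) p w m → entryFrom (f p) (map f w) m ≡ f (entryFrom p w m)
entryFrom-map f p w        zero    = refl
entryFrom-map f p []       (suc m) = refl
entryFrom-map f p (x ∷ xs) (suc m) = entryFrom-map f x xs m

entryFrom-0ℤ : ∀ w m → m ≤ length w → entryFrom 0ℤ w m ≡ entry w m
entryFrom-0ℤ []       zero          _       = refl
entryFrom-0ℤ (x ∷ xs) zero          _       = refl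
entryFrom-0ℤ (x ∷ xs) (suc zero)    _       = refl
entryFrom-0ℤ (x ∷ xs) (suc (suc i)) (s≤s h) = go x xs i h
  where
    go : ∀ x xs i → suc i ≤ length xs → entryFrom x xs (suc i) ≡ entry xs (suc i)
    go x (y ∷ ys) zero    _       = refl
    go x (y ∷ ys) (suc i) (s≤s h) = go y ys i h

signed : InsSign → ℕ → ℤ
signed plus  j = + j
signed minus j = - (+ j)

insertion-≡ : ∀ s i j σ → insertion s i j σ ≡ insertAt i (signed s j) (map (shift j) σ)
insertion-≡ plus  i j σ = refl
insertion-≡ minus i j σ = refl

-- The number of descents among a, ±j, b after inserting ±j between a and b, with
-- a and b read before the shift by j.
newDescents : InsSign → ℤ → ℤ → ℕ → ℕ
newDescents plus  a b j = 𝟙 (+ j ℤ.≤ᵇ a) ℕ.+ 𝟙 (not (+ j ℤ.≤ᵇ b))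
newDescents minus a b j = 𝟙 (not (a ℤ.≤ᵇ - (+ j))) ℕ.+ 𝟙 (b ℤ.≤ᵇ - (+ j))

newDescents-shift : ∀ s j′ a b →
  𝟙 (shift (suc j′) a >ᵇ signed s (suc j′)) ℕ.+ 𝟙 (signed s (suc j′) >ᵇ shift (suc j′) b)
  ≡ newDescents s a b (suc j′)
newDescents-shift plus  j′ a b = cong₂ ℕ._+_ (cong 𝟙 (shift>ᵇ[+j] j′ a)) (cong 𝟙 ([+j]>ᵇshift j′ b))
newDescents-shift minus j′ a b = cong₂ ℕ._+_ (cong 𝟙 (shift>ᵇ[-j] j′ a)) (cong 𝟙 ([-j]>ᵇshift j′ b))

desB-insertion-interior : ∀ s σ m j′ → suc m ≤ length σ →
  desB (insertion s (suc m) (suc j′) σ) ℕ.+ 𝟙 (entry σ m >ᵇ entry σ (suc m))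
  ≡ desB σ ℕ.+ newDescents s (entry σ m) (entry σ (suc m)) (suc j′)
desB-insertion-interior s σ m j′ m<∣σ∣ = begin
  desB (insertion s (suc m) j σ) ℕ.+ 𝟙 (a >ᵇ b)
    ≡⟨ cong (λ z → desB z ℕ.+ 𝟙 (a >ᵇ b)) (insertion-≡ s (suc m) j σ) ⟩
  desB σ′ ℕ.+ 𝟙 (a >ᵇ b)
    ≡⟨ cong (λ z → desB σ′ ℕ.+ 𝟙 z) (sym (shift->ᵇ j a b)) ⟩
  desB σ′ ℕ.+ 𝟙 (shift j a >ᵇ shift j b)
    ≡⟨ cong₂ (λ z z′ → desB σ′ ℕ.+ 𝟙 (z >ᵇ z′)) (sym before) (sym after) ⟩
  desB σ′ ℕ.+ 𝟙 (entryFrom 0ℤ w m >ᵇ entryFrom 0ℤ w (suc m))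
    ≡⟨ desFrom-insert 0ℤ w m v (subst (suc m ≤_) (sym (length-map (shift j) σ)) m<∣σ∣) ⟩
  desB w ℕ.+ (𝟙 (entryFrom 0ℤ w m >ᵇ v) ℕ.+ 𝟙 (v >ᵇ entryFrom 0ℤ w (suc m)))
    ≡⟨ cong₂ (λ z z′ → desB w ℕ.+ (𝟙 (z >ᵇ v) ℕ.+ 𝟙 (v >ᵇ z′))) before after ⟩
  desB w ℕ.+ (𝟙 (shift j a >ᵇ v) ℕ.+ 𝟙 (v >ᵇ shift j b))
    ≡⟨ cong₂ ℕ._+_ (desFrom-map (shift j) (shift->ᵇ j) 0ℤ σ) (newDescents-shift s j′ a b) ⟩
  desB σ ℕ.+ newDescents s a b j ∎
  where
    open ≡-Reasoning
    j = suc j′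
    a = entry σ m
    b = entry σ (suc m)
    w = map (shift j) σ
    v = signed s j
    σ′ = take m w ++ v ∷ drop m w
    before : entryFrom 0ℤ w m ≡ shift j a
    before = trans (entryFrom-map (shift j) 0ℤ σ m) (cong (shift j) (entryFrom-0ℤ σ m (ℕP.<⇒≤ m<∣σ∣)))
    after : entryFrom 0ℤ w (suc m) ≡ shift j b
    after = trans (entryFrom-map (shift j) 0ℤ σ (suc m)) (cong (shift j) (entryFrom-0ℤ σ (suc m) m<∣σ∣))

desB-insertion-last : ∀ s σ j′ →
  desB (insertion s (suc (length σ)) (suc j′) σ)
  ≡ desB σ ℕ.+ 𝟙 (shift (suc j′) (entry σ (length σ)) >ᵇ signed s (suc j′))
desB-insertion-last s σ j′ = begin
  desB (insertion s (suc (length σ)) j σ)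
    ≡⟨ cong desB (insertion-≡ s (suc (length σ)) j σ) ⟩
  desB (take (length σ) w ++ v ∷ drop (length σ) w)
    ≡⟨ cong (λ z → desB (take z w ++ v ∷ drop z w)) (sym (length-map (shift j) σ)) ⟩
  desB (take (length w) w ++ v ∷ drop (length w) w)
    ≡⟨ desFrom-append 0ℤ w v ⟩
  desB w ℕ.+ 𝟙 (entryFrom 0ℤ w (length w) >ᵇ v)
    ≡⟨ cong₂ (λ z z′ → z ℕ.+ 𝟙 (z′ >ᵇ v)) (desFrom-map (shift j) (shift->ᵇ j) 0ℤ σ) last ⟩
  desB σ ℕ.+ 𝟙 (shift j (entry σ (length σ)) >ᵇ v) ∎
  where
    open ≡-Reasoning
    j = suc j′
    w = map (shift j) σ
    v = signed s j
    last : entryFrom 0ℤ w (length w) ≡ shift j (entry σ (length σ))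
    last = trans (cong (entryFrom 0ℤ w) (length-map (shift j) σ))
             (trans (entryFrom-map (shift j) 0ℤ σ (length σ))
                    (cong (shift j) (entryFrom-0ℤ σ (length σ) ℕP.≤-refl)))

record EntrywiseSignedPerm (n : ℕ) (σ : Word) : Set where
  field
    length≡   : length σ ≡ n
    bounded   : ∀ r → 1 ≤ r → r ≤ n → 1 ≤ ∣ entry σ r ∣ × ∣ entry σ r ∣ ≤ n
    injective : ∀ r r′ → 1 ≤ r → r ≤ n → 1 ≤ r′ → r′ ≤ n → ∣ entry σ r ∣ ≡ ∣ entry σ r′ ∣ → r ≡ r′

entry-zero : ∀ σ → entry σ 0 ≡ 0ℤ
entry-zero []       = refl
entry-zero (x ∷ xs) = refl

entry-beyond : ∀ σ r → length σ < r → entry σ r ≡ 0ℤ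
entry-beyond []       r             _       = refl
entry-beyond (x ∷ xs) (suc zero)    (s≤s ())
entry-beyond (x ∷ xs) (suc (suc r)) (s≤s h) = entry-beyond xs (suc r) h

∣entry∣≤n : ∀ {n σ} → EntrywiseSignedPerm n σ → ∀ r → ∣ entry σ r ∣ ≤ n
∣entry∣≤n {n} {σ} P zero rewrite entry-zero σ = z≤n
∣entry∣≤n {n} {σ} P (suc r) with ℕP.≤-<-connex (suc r) n
... | inj₁ h = proj₂ (EntrywiseSignedPerm.bounded P (suc r) (s≤s z≤n) h)
... | inj₂ h rewrite entry-beyond σ (suc r) (subst (_< suc r) (sym (EntrywiseSignedPerm.length≡ P)) h) = z≤n

-- Reading σ₍ₙ₊₁₎ as n + 1, larger than every entry, lets insertion at the end be
-- treated like an interior insertion.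
entryOrTop : ℕ → Word → ℕ → ℤ
entryOrTop n σ L = if L ℕ.≤ᵇ n then entry σ L else + suc n

top-not-below : ∀ n a → ∣ a ∣ ≤ n → (a >ᵇ (+ suc n)) ≡ false
top-not-below n (+ m)    h rewrite ≤⇒≤ᵇ≡true (ℕP.m≤n⇒m≤1+n h) = refl
top-not-below n -[1+ m ] h = refl

newDescents-top : ∀ s n a j′ → ∣ a ∣ ≤ n → suc j′ ≤ suc n →
  𝟙 (shift (suc j′) a >ᵇ signed s (suc j′)) ℕ.+ 𝟙 (a >ᵇ (+ suc n)) ≡ newDescents s a (+ suc n) (suc j′)
newDescents-top plus  n a j′ ha hj rewrite top-not-below n a ha | shift>ᵇ[+j] j′ a | ≤⇒≤ᵇ≡true hj = refl
newDescents-top minus n a j′ ha hj rewrite top-not-below n a ha | shift>ᵇ[-j] j′ a = refl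

desB-insertion : ∀ s {n σ} → EntrywiseSignedPerm n σ → ∀ L j → 1 ≤ L → L ≤ suc n → 1 ≤ j → j ≤ suc n →
  desB (insertion s L j σ) ℕ.+ 𝟙 (entry σ (L ∸ 1) >ᵇ entryOrTop n σ L)
  ≡ desB σ ℕ.+ newDescents s (entry σ (L ∸ 1)) (entryOrTop n σ L) j
desB-insertion s {n} {σ} P (suc m) (suc j′) _ (s≤s m≤n) _ j≤n+1 with ℕP.m≤n⇒m<n∨m≡n m≤n
... | inj₁ m<n rewrite ≤⇒≤ᵇ≡true m<n =
  desB-insertion-interior s σ m j′ (subst (suc m ≤_) (sym length≡) m<n)
  where open EntrywiseSignedPerm P
... | inj₂ refl rewrite >⇒≤ᵇ≡false (ℕP.n<1+n m) = begin
  desB (insertion s (suc m) j σ) ℕ.+ 𝟙 (a >ᵇ top)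
    ≡⟨ cong (λ z → desB (insertion s (suc z) j σ) ℕ.+ 𝟙 (a >ᵇ top)) (sym length≡) ⟩
  desB (insertion s (suc (length σ)) j σ) ℕ.+ 𝟙 (a >ᵇ top)
    ≡⟨ cong (ℕ._+ 𝟙 (a >ᵇ top)) (desB-insertion-last s σ j′) ⟩
  (desB σ ℕ.+ 𝟙 (shift j (entry σ (length σ)) >ᵇ v)) ℕ.+ 𝟙 (a >ᵇ top)
    ≡⟨ cong (λ z → (desB σ ℕ.+ 𝟙 (shift j (entry σ z) >ᵇ v)) ℕ.+ 𝟙 (a >ᵇ top)) length≡ ⟩
  (desB σ ℕ.+ 𝟙 (shift j a >ᵇ v)) ℕ.+ 𝟙 (a >ᵇ top)
    ≡⟨ ℕP.+-assoc (desB σ) _ _ ⟩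
  desB σ ℕ.+ (𝟙 (shift j a >ᵇ v) ℕ.+ 𝟙 (a >ᵇ top))
    ≡⟨ cong (desB σ ℕ.+_) (newDescents-top s m a j′ (∣entry∣≤n P m) j≤n+1) ⟩
  desB σ ℕ.+ newDescents s a top j ∎
  where
    open ≡-Reasoning
    open EntrywiseSignedPerm P
    j = suc j′
    a = entry σ m
    v = signed s j
    top = + suc m

⊖≡+⇒≡+ : ∀ X Y p → X ⊖ Y ≡ + p → X ≡ Y ℕ.+ p
⊖≡+⇒≡+ X       zero    p e = cong ∣_∣ e
⊖≡+⇒≡+ zero    (suc Y) p ()
⊖≡+⇒≡+ (suc X) (suc Y) p e = cong suc (⊖≡+⇒≡+ X Y p (trans (sym (ℤP.[1+m]⊖[1+n]≡m⊖n X Y)) e))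

[m+p]⊖m≡p : ∀ m p → (m ℕ.+ p) ⊖ m ≡ + p
[m+p]⊖m≡p m p = trans (ℤP.⊖-≥ (ℕP.m≤m+n m p)) (cong +_ (ℕP.m+n∸m≡n m p))

⊖-balance : ∀ X Y C E p → X ℕ.+ C ≡ Y ℕ.+ E → (X ⊖ Y ≡ + p) ⇔ (E ≡ C ℕ.+ p)
⊖-balance X Y C E p h = mk⇔ to from
  where
    to : X ⊖ Y ≡ + p → E ≡ C ℕ.+ p
    to e = ℕP.+-cancelˡ-≡ Y E (C ℕ.+ p) (begin
      Y ℕ.+ E          ≡⟨ sym h ⟩
      X ℕ.+ C          ≡⟨ cong (ℕ._+ C) (⊖≡+⇒≡+ X Y p e) ⟩
      Y ℕ.+ p ℕ.+ C    ≡⟨ ℕP.+-assoc Y p C ⟩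
      Y ℕ.+ (p ℕ.+ C)  ≡⟨ cong (Y ℕ.+_) (ℕP.+-comm p C) ⟩
      Y ℕ.+ (C ℕ.+ p)  ∎)
      where open ≡-Reasoning
    from : E ≡ C ℕ.+ p → X ⊖ Y ≡ + p
    from e = subst (λ z → z ⊖ Y ≡ + p) (sym X≡Y+p) ([m+p]⊖m≡p Y p)
      where
        open ≡-Reasoning
        X≡Y+p : X ≡ Y ℕ.+ p
        X≡Y+p = ℕP.+-cancelʳ-≡ C X (Y ℕ.+ p) (begin
          X ℕ.+ C          ≡⟨ h ⟩
          Y ℕ.+ E          ≡⟨ cong (Y ℕ.+_) e ⟩
          Y ℕ.+ (C ℕ.+ p)  ≡⟨ cong (Y ℕ.+_) (ℕP.+-comm C p) ⟩
          Y ℕ.+ (p ℕ.+ C)  ≡⟨ ℕP.+-assoc Y p C ⟨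
          Y ℕ.+ p ℕ.+ C    ∎)

ℤ-≤ᵇ-refl : ∀ x → (x ℤ.≤ᵇ x) ≡ true
ℤ-≤ᵇ-refl x = Equivalence.to T-≡ (ℤP.≤⇒≤ᵇ (ℤP.≤-refl {x}))

+[1+k]≤ᵇ+k : ∀ k → (+ suc k ℤ.≤ᵇ + k) ≡ false
+[1+k]≤ᵇ+k k = >⇒≤ᵇ≡false (ℕP.n<1+n k)

-[1+k]≤ᵇ-[2+k] : ∀ k → (-[1+ k ] ℤ.≤ᵇ -[1+ suc k ]) ≡ false
-[1+k]≤ᵇ-[2+k] k = >⇒≤ᵇ≡false (ℕP.n<1+n k)

suc≤ᵇ≡not≥ᵇ : ∀ x y → (suc x ℕ.≤ᵇ y) ≡ not (y ℕ.≤ᵇ x)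
suc≤ᵇ≡not≥ᵇ x y with ℕP.≤-<-connex y x
... | inj₁ h rewrite ≤⇒≤ᵇ≡true h | >⇒≤ᵇ≡false {suc x} {y} (s≤s h) = refl
... | inj₂ h rewrite >⇒≤ᵇ≡false h | ≤⇒≤ᵇ≡true {suc x} {y} h = refl

+[1+k]≤ᵇ≡not≤ᵇ+k : ∀ k a → (+ suc k ℤ.≤ᵇ a) ≡ not (a ℤ.≤ᵇ + k)
+[1+k]≤ᵇ≡not≤ᵇ+k k (+ m)    = suc≤ᵇ≡not≥ᵇ k m
+[1+k]≤ᵇ≡not≤ᵇ+k k -[1+ m ] = refl

≤ᵇ-[2+k]≡not-[1+k]≤ᵇ : ∀ k b → (b ℤ.≤ᵇ - (+ suc (suc k))) ≡ not (- (+ suc k) ℤ.≤ᵇ b)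
≤ᵇ-[2+k]≡not-[1+k]≤ᵇ k (+ m)    = refl
≤ᵇ-[2+k]≡not-[1+k]≤ᵇ k -[1+ m ] = suc≤ᵇ≡not≥ᵇ k m

+[1+k]≤ᵇ≡+k≤ᵇ : ∀ k b → b ≢ + k → (+ suc k ℤ.≤ᵇ b) ≡ (+ k ℤ.≤ᵇ b)
+[1+k]≤ᵇ≡+k≤ᵇ k (+ m) b≢k = ≤ᵇ-cong {suc k} {m} {k} {m} ℕP.<⇒≤
  (λ m<1+k → ℕP.≤∧≢⇒< (s≤s⁻¹ m<1+k) (b≢k ∘ cong +_))
+[1+k]≤ᵇ≡+k≤ᵇ k -[1+ m ] _ = refl

≤ᵇ-[2+k]≡≤ᵇ-[1+k] : ∀ k b → b ≢ - (+ suc k) → (b ℤ.≤ᵇ - (+ suc (suc k))) ≡ (b ℤ.≤ᵇ - (+ suc k))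
≤ᵇ-[2+k]≡≤ᵇ-[1+k] k (+ m)    _   = refl
≤ᵇ-[2+k]≡≤ᵇ-[1+k] k -[1+ m ] b≢k = ≤ᵇ-cong {suc k} {m} {k} {m} ℕP.<⇒≤
  (λ m<1+k → ℕP.≤∧≢⇒< (s≤s⁻¹ m<1+k) (b≢k ∘ cong -[1+_]))

Drop Rise : ℕ → ℕ → ℕ → Set
Drop e e′ c = e ≡ 1 ℕ.+ c × e′ ≡ c
Rise e e′ c = e ≡ c × e′ ≡ 1 ℕ.+ c

-- The change of newDescents s a b across column c when the entry a above the line,
-- resp. b below it, is signed s c, i.e. a square of sign s.
CrossAbove CrossBelow : InsSign → ℕ → ℕ → ℕ → Set
CrossAbove plus  = Drop
CrossAbove minus = Rise
CrossBelow plus  = Rise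
CrossBelow minus = Drop

newDescents-above : ∀ s k a b → a ≡ signed s (suc k) → b ≢ signed s (suc k) →
  CrossAbove s (newDescents s a b (suc k)) (newDescents s a b (suc (suc k))) (𝟙 (a >ᵇ b))
newDescents-above plus k .(+ suc k) b refl b≢
  rewrite ℤ-≤ᵇ-refl (+ suc k) | +[1+k]≤ᵇ+k (suc k) | +[1+k]≤ᵇ≡+k≤ᵇ (suc k) b b≢ = refl , refl
newDescents-above minus k .(- (+ suc k)) b refl b≢
  rewrite ℤ-≤ᵇ-refl -[1+ k ] | -[1+k]≤ᵇ-[2+k] k =
  cong 𝟙 (trans (sym (≤ᵇ-[2+k]≡≤ᵇ-[1+k] k b b≢)) (≤ᵇ-[2+k]≡not-[1+k]≤ᵇ k b)) ,
  cong (λ z → 1 ℕ.+ 𝟙 z) (≤ᵇ-[2+k]≡not-[1+k]≤ᵇ k b)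

newDescents-below : ∀ s k a b → b ≡ signed s (suc k) → a ≢ signed s (suc k) →
  CrossBelow s (newDescents s a b (suc k)) (newDescents s a b (suc (suc k))) (𝟙 (a >ᵇ b))
newDescents-below plus k a .(+ suc k) refl a≢
  rewrite ℤ-≤ᵇ-refl (+ suc k) | +[1+k]≤ᵇ+k (suc k) =
  trans (ℕP.+-identityʳ _) (cong 𝟙 (trans (sym (+[1+k]≤ᵇ≡+k≤ᵇ (suc k) a a≢)) (+[1+k]≤ᵇ≡not≤ᵇ+k (suc k) a))) ,
  trans (ℕP.+-comm (𝟙 (+ suc (suc k) ℤ.≤ᵇ a)) 1) (cong (λ z → 1 ℕ.+ 𝟙 z) (+[1+k]≤ᵇ≡not≤ᵇ+k (suc k) a))
newDescents-below minus k a .(- (+ suc k)) refl a≢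
  rewrite ℤ-≤ᵇ-refl -[1+ k ] | -[1+k]≤ᵇ-[2+k] k =
  ℕP.+-comm (𝟙 (not (a ℤ.≤ᵇ -[1+ k ]))) 1 ,
  trans (ℕP.+-identityʳ _) (cong (𝟙 ∘ not) (≤ᵇ-[2+k]≡≤ᵇ-[1+k] k a a≢))

newDescents-clear : ∀ s k a b → a ≢ signed s (suc k) → b ≢ signed s (suc k) →
  newDescents s a b (suc k) ≡ newDescents s a b (suc (suc k))
newDescents-clear plus  k a b a≢ b≢ rewrite +[1+k]≤ᵇ≡+k≤ᵇ (suc k) a a≢ | +[1+k]≤ᵇ≡+k≤ᵇ (suc k) b b≢ = refl
newDescents-clear minus k a b a≢ b≢ rewrite ≤ᵇ-[2+k]≡≤ᵇ-[1+k] k a a≢ | ≤ᵇ-[2+k]≡≤ᵇ-[1+k] k b b≢ = refl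

-- Filled squares and the rule along a line

SignedSq : InsSign → Word → ℕ → ℕ → Set
SignedSq s σ r c = 1 ≤ c × entry σ r ≡ signed s c

SignedSq? : ∀ s σ r c → Dec (SignedSq s σ r c)
SignedSq? s σ r c = (1 ℕ.≤? c) ×-dec (entry σ r ℤ.≟ signed s c)

∣signed∣ : ∀ s c → ∣ signed s c ∣ ≡ c
∣signed∣ plus  c       = refl
∣signed∣ minus zero    = refl
∣signed∣ minus (suc c) = refl

SignedSq⇒Filled : ∀ s {σ r c} → SignedSq s σ r c → FilledSq σ r c
SignedSq⇒Filled plus  sq = inj₁ sq
SignedSq⇒Filled minus sq = inj₂ sq

Filled⇒SignedSq : ∀ {σ r c} → FilledSq σ r c → ∃ λ s → SignedSq s σ r c
Filled⇒SignedSq (inj₁ sq) = plus , sq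
Filled⇒SignedSq (inj₂ sq) = minus , sq

nonzero-entry-inside : ∀ σ r → ∣ entry σ r ∣ ≢ 0 → 1 ≤ r × r ≤ length σ
nonzero-entry-inside σ zero    ≢0 = ⊥-elim (≢0 (cong ∣_∣ (entry-zero σ)))
nonzero-entry-inside σ (suc r) ≢0 with ℕP.≤-<-connex (suc r) (length σ)
... | inj₁ r≤∣σ∣ = s≤s z≤n , r≤∣σ∣
... | inj₂ ∣σ∣<r = ⊥-elim (≢0 (cong ∣_∣ (entry-beyond σ (suc r) ∣σ∣<r)))

SignedSq-inside : ∀ {s n σ r c} → EntrywiseSignedPerm n σ → SignedSq s σ r c → (1 ≤ r × r ≤ n) × (1 ≤ c × c ≤ n)
SignedSq-inside {s} {n} {σ} {r} {c} P (1≤c , e) =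
  (proj₁ r-inside , subst (r ≤_) (EntrywiseSignedPerm.length≡ P) (proj₂ r-inside)) ,
  (1≤c , subst (_≤ n) ∣entry∣≡c (∣entry∣≤n P r))
  where
    ∣entry∣≡c : ∣ entry σ r ∣ ≡ c
    ∣entry∣≡c = trans (cong ∣_∣ e) (∣signed∣ s c)
    r-inside = nonzero-entry-inside σ r (λ ∣e∣≡0 → ℕP.<⇒≢ 1≤c (sym (trans (sym ∣entry∣≡c) ∣e∣≡0)))

SignedSq-column-unique : ∀ {s s′ n σ r r′ c} → EntrywiseSignedPerm n σ →
  SignedSq s σ r c → SignedSq s′ σ r′ c → r ≡ r′
SignedSq-column-unique {s} {s′} {c = c} P sq sq′ with SignedSq-inside {s} P sq | SignedSq-inside {s′} P sq′
... | ((1≤r , r≤n) , _) | ((1≤r′ , r′≤n) , _) =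
  EntrywiseSignedPerm.injective P _ _ 1≤r r≤n 1≤r′ r′≤n
    (trans (cong ∣_∣ (proj₂ sq)) (trans (∣signed∣ s c) (sym (trans (cong ∣_∣ (proj₂ sq′)) (∣signed∣ s′ c)))))

AbovePattern BelowPattern : Dir → Set → Set → Set
AbovePattern down X Y = ¬ X × Y
AbovePattern up   X Y = X × ¬ Y
BelowPattern down X Y = X × ¬ Y
BelowPattern up   X Y = ¬ X × Y

record LineRule (n : ℕ) (In Sq : ℕ → ℕ → Set) (dir : Dir) : Set where
  field
    typed-inside  : ∀ {L k} → In L k → (1 ≤ L × L ≤ suc n) × (1 ≤ k × k ≤ suc n)
    typed?        : ∀ L k → Dec (In L k)
    square-inside : ∀ {L k} → Sq L k → (1 ≤ L × L ≤ n) × (1 ≤ k × k ≤ n)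
    square?       : ∀ L k → Dec (Sq L k)
    square-unique : ∀ {L L′ k} → Sq L k → Sq L′ k → L ≡ L′
    square-above  : ∀ L k → Sq L k → ¬ Sq (suc L) k → AbovePattern dir (In (suc L) k) (In (suc L) (suc k))
    square-below  : ∀ L k → Sq (suc L) k → ¬ Sq L k → BelowPattern dir (In (suc L) k) (In (suc L) (suc k))
    no-square     : ∀ L k → L ≤ n → 1 ≤ k → k ≤ n → ¬ Sq L k → ¬ Sq (suc L) k →
                    (In (suc L) k → In (suc L) (suc k)) × (In (suc L) (suc k) → In (suc L) k)

data Claimed : InsSign → ℕ → Dir → Set where
  plus-0  : Claimed plus  0 down
  plus-1  : Claimed plus  1 up
  minus-0 : Claimed minus 0 up
  minus-1 : Claimed minus 1 down

module HorizontalLines {n σ} (P : EntrywiseSignedPerm n σ) (s : InsSign) (p : ℕ) where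

  In : ℕ → ℕ → Set
  In L k = TypePt n σ s horiz p (L , k)

  Sq : ℕ → ℕ → Set
  Sq = SignedSq s σ

  above below : ℕ → ℤ
  above L = entry σ (L ∸ 1)
  below L = entryOrTop n σ L

  E : ℕ → ℕ → ℕ
  E L k = newDescents s (above L) (below L) k

  C : ℕ → ℕ
  C L = 𝟙 (above L >ᵇ below L)

  typed⇔ : ∀ {L k} → 1 ≤ L → L ≤ suc n → 1 ≤ k → k ≤ suc n → (d σ s horiz L k ≡ + p) ⇔ (E L k ≡ C L ℕ.+ p)
  typed⇔ {L} {k} 1≤L L≤n+1 1≤k k≤n+1 =
    ⊖-balance _ _ (C L) (E L k) p (desB-insertion s P L k 1≤L L≤n+1 1≤k k≤n+1)

  typed⇒ : ∀ {L k} → In L k → E L k ≡ C L ℕ.+ p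
  typed⇒ ((1≤L , L≤n+1) , (1≤k , k≤n+1) , t) = Equivalence.to (typed⇔ 1≤L L≤n+1 1≤k k≤n+1) t

  ⇒typed : ∀ {L k} → (1 ≤ L × L ≤ suc n) → (1 ≤ k × k ≤ suc n) → E L k ≡ C L ℕ.+ p → In L k
  ⇒typed (1≤L , L≤n+1) (1≤k , k≤n+1) e = (1≤L , L≤n+1) , (1≤k , k≤n+1) , Equivalence.from (typed⇔ 1≤L L≤n+1 1≤k k≤n+1) e

  below-inside : ∀ L → L ≤ n → below L ≡ entry σ L
  below-inside L L≤n rewrite ≤⇒≤ᵇ≡true L≤n = refl

  below-top : below (suc n) ≡ + suc n
  below-top rewrite >⇒≤ᵇ≡false (ℕP.n<1+n n) = refl

  below≢ : ∀ L k → L ≤ n → 1 ≤ k → k ≤ n → ¬ Sq (suc L) k → below (suc L) ≢ signed s k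
  below≢ L k L≤n 1≤k k≤n no-sq e with ℕP.m≤n⇒m<n∨m≡n L≤n
  ... | inj₁ L<n  = no-sq (1≤k , trans (sym (below-inside (suc L) L<n)) e)
  ... | inj₂ refl = top≢ s k k≤n (trans (sym below-top) e)
    where
      top≢ : ∀ s k → k ≤ L → + suc L ≢ signed s k
      top≢ plus  k k≤L e′ = ℕP.<-irrefl (sym (cong ∣_∣ e′)) (s≤s k≤L)
      top≢ minus zero    _ ()
      top≢ minus (suc k) _ ()

  above≢ : ∀ L k → 1 ≤ k → ¬ Sq L k → above (suc L) ≢ signed s k
  above≢ L k 1≤k no-sq e = no-sq (1≤k , e)

  cross-above : ∀ L k → Sq L k → ¬ Sq (suc L) k → CrossAbove s (E (suc L) k) (E (suc L) (suc k)) (C (suc L))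
  cross-above L (suc k) sq no-sq with SignedSq-inside {s} P sq
  ... | ((_ , L≤n) , (1≤k , k≤n)) =
    newDescents-above s k (above (suc L)) (below (suc L)) (proj₂ sq) (below≢ L (suc k) L≤n 1≤k k≤n no-sq)

  cross-below : ∀ L k → Sq (suc L) k → ¬ Sq L k → CrossBelow s (E (suc L) k) (E (suc L) (suc k)) (C (suc L))
  cross-below L (suc k) sq no-sq with SignedSq-inside {s} P sq
  ... | ((_ , L<n) , (1≤k , _)) =
    newDescents-below s k (above (suc L)) (below (suc L)) (trans (below-inside (suc L) L<n) (proj₂ sq))
      (above≢ L (suc k) 1≤k no-sq)

  cross-clear : ∀ L k → L ≤ n → 1 ≤ k → k ≤ n → ¬ Sq L k → ¬ Sq (suc L) k → E (suc L) k ≡ E (suc L) (suc k)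
  cross-clear L (suc k) L≤n 1≤k k≤n no-sq no-sq′ =
    newDescents-clear s k (above (suc L)) (below (suc L)) (above≢ L (suc k) 1≤k no-sq) (below≢ L (suc k) L≤n 1≤k k≤n no-sq′)

  step-inside : ∀ {L k} → suc L ≤ suc n → 1 ≤ k → k ≤ n →
    (1 ≤ suc L × suc L ≤ suc n) × (1 ≤ k × k ≤ suc n) × (1 ≤ suc k × suc k ≤ suc n)
  step-inside L≤n 1≤k k≤n = (s≤s z≤n , L≤n) , (1≤k , ℕP.m≤n⇒m≤1+n k≤n) , (s≤s z≤n , s≤s k≤n)

  ¬typed₀ : ∀ {L k} → E L k ≡ 1 ℕ.+ C L → p ≡ 0 → ¬ In L k
  ¬typed₀ {L} e refl t = ℕP.1+n≢n (trans (sym e) (trans (typed⇒ t) (ℕP.+-identityʳ (C L))))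

  ¬typed₁ : ∀ {L k} → E L k ≡ C L → p ≡ 1 → ¬ In L k
  ¬typed₁ {L} e refl t = ℕP.1+n≢n (sym (trans (sym e) (trans (typed⇒ t) (ℕP.+-comm (C L) 1))))

  typed₁ : ∀ {L k} → (1 ≤ L × L ≤ suc n) → (1 ≤ k × k ≤ suc n) → E L k ≡ 1 ℕ.+ C L → p ≡ 1 → In L k
  typed₁ {L} bL bk e refl = ⇒typed bL bk (trans e (ℕP.+-comm 1 (C L)))

  typed₀ : ∀ {L k} → (1 ≤ L × L ≤ suc n) → (1 ≤ k × k ≤ suc n) → E L k ≡ C L → p ≡ 0 → In L k
  typed₀ {L} bL bk e refl = ⇒typed bL bk (trans e (sym (ℕP.+-identityʳ (C L))))

  at-square-above : ∀ {dir} → Claimed s p dir → ∀ L k → Sq L k → ¬ Sq (suc L) k →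
    AbovePattern dir (In (suc L) k) (In (suc L) (suc k))
  at-square-above c L k sq no-sq with SignedSq-inside {s} P sq
  ... | ((_ , L≤n) , (1≤k , k≤n)) with step-inside (s≤s L≤n) 1≤k k≤n | c | cross-above L k sq no-sq
  ... | (bL , bk , bk′) | plus-0  | (e , e′) = ¬typed₀ e refl , typed₀ bL bk′ e′ refl
  ... | (bL , bk , bk′) | plus-1  | (e , e′) = typed₁ bL bk e refl , ¬typed₁ e′ refl
  ... | (bL , bk , bk′) | minus-0 | (e , e′) = typed₀ bL bk e refl , ¬typed₀ e′ refl
  ... | (bL , bk , bk′) | minus-1 | (e , e′) = ¬typed₁ e refl , typed₁ bL bk′ e′ refl

  at-square-below : ∀ {dir} → Claimed s p dir → ∀ L k → Sq (suc L) k → ¬ Sq L k →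
    BelowPattern dir (In (suc L) k) (In (suc L) (suc k))
  at-square-below c L k sq no-sq with SignedSq-inside {s} P sq
  ... | ((_ , L<n) , (1≤k , k≤n)) with step-inside (ℕP.m≤n⇒m≤1+n L<n) 1≤k k≤n | c | cross-below L k sq no-sq
  ... | (bL , bk , bk′) | plus-0  | (e , e′) = typed₀ bL bk e refl , ¬typed₀ e′ refl
  ... | (bL , bk , bk′) | plus-1  | (e , e′) = ¬typed₁ e refl , typed₁ bL bk′ e′ refl
  ... | (bL , bk , bk′) | minus-0 | (e , e′) = ¬typed₀ e refl , typed₀ bL bk′ e′ refl
  ... | (bL , bk , bk′) | minus-1 | (e , e′) = typed₁ bL bk e refl , ¬typed₁ e′ refl

  away-from-squares : ∀ L k → L ≤ n → 1 ≤ k → k ≤ n → ¬ Sq L k → ¬ Sq (suc L) k →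
    (In (suc L) k → In (suc L) (suc k)) × (In (suc L) (suc k) → In (suc L) k)
  away-from-squares L k L≤n 1≤k k≤n no-sq no-sq′ =
    (λ t → ⇒typed bL bk′ (trans (sym same) (typed⇒ t))) ,
    (λ t → ⇒typed bL bk (trans same (typed⇒ t)))
    where
      same = cross-clear L k L≤n 1≤k k≤n no-sq no-sq′
      bL = proj₁ (step-inside (s≤s L≤n) 1≤k k≤n)
      bk = proj₁ (proj₂ (step-inside (s≤s L≤n) 1≤k k≤n))
      bk′ = proj₂ (proj₂ (step-inside (s≤s L≤n) 1≤k k≤n))

horizontalRule : ∀ {n σ} → EntrywiseSignedPerm n σ → ∀ {s p dir} → Claimed s p dir →
  LineRule n (λ L k → TypePt n σ s horiz p (L , k)) (SignedSq s σ) dir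
horizontalRule {n} {σ} P {s} {p} c = record
  { typed-inside  = λ t → proj₁ t , proj₁ (proj₂ t)
  ; typed?        = λ L k → ((1 ℕ.≤? L) ×-dec (L ℕ.≤? suc n))
                            ×-dec (((1 ℕ.≤? k) ×-dec (k ℕ.≤? suc n)) ×-dec (d σ s horiz L k ℤ.≟ + p))
  ; square-inside = SignedSq-inside {s} P
  ; square?       = SignedSq? s σ
  ; square-unique = SignedSq-column-unique {s} {s} P
  ; square-above  = at-square-above c
  ; square-below  = at-square-below c
  ; no-square     = away-from-squares
  }
  where open HorizontalLines P s p

-- Paths determined by a line rule

pt-injective : ∀ o {L k L′ k′} → pt o L k ≡ pt o L′ k′ → L ≡ L′ × k ≡ k′
pt-injective horiz refl = refl , refl
pt-injective vert  refl = refl , refl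

along-pt : ∀ o L k → along o (pt o L k) ≡ k
along-pt horiz L k = refl
along-pt vert  L k = refl

pt-surjective : ∀ o u → ∃ λ L → ∃ λ k → u ≡ pt o L k
pt-surjective horiz (i , j) = i , j , refl
pt-surjective vert  (i , j) = j , i , refl

n≢1+n : ∀ {m} → m ≢ suc m
n≢1+n e = ℕP.1+n≢n (sym e)

module Segments (n : ℕ) (π : Word) (o : Orient) (T : Point → Set)
  (typed-inside : ∀ {L k} → T (pt o L k) → (1 ≤ L × L ≤ suc n) × (1 ≤ k × k ≤ suc n))
  (typed? : ∀ L k → Dec (T (pt o L k))) where

  open PathConstruction n π o T

  AllTyped : ℕ → ℕ → ℕ → Set
  AllTyped L l r = ∀ k → l ≤ k → k ≤ r → InT L k

  single : ∀ {L k} → InT L k → AllTyped L k k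
  single t k′ k≤k′ k′≤k = subst (InT _) (ℕP.≤-antisym k≤k′ k′≤k) t

  RunTo : ℕ → ℕ → Set
  RunTo L r = ∃ λ l → 1 ≤ l × l ≤ r × AllTyped L l r × (l ≡ 1 ⊎ ¬ InT L (l ∸ 1))

  RunFrom : ℕ → ℕ → Set
  RunFrom L l = ∃ λ r → l ≤ r × r ≤ suc n × AllTyped L l r × (r ≡ suc n ⊎ ¬ InT L (suc r))

  extendRight : ∀ {L l r} → AllTyped L l r → InT L (suc r) → AllTyped L l (suc r)
  extendRight all t k l≤k k≤r+1 with ℕP.m≤n⇒m<n∨m≡n k≤r+1
  ... | inj₁ k<r+1 = all k l≤k (s≤s⁻¹ k<r+1)
  ... | inj₂ refl  = t

  extendLeft : ∀ {L l r} → InT L l → AllTyped L (suc l) r → AllTyped L l r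
  extendLeft t all k l≤k k≤r with ℕP.m≤n⇒m<n∨m≡n l≤k
  ... | inj₁ l<k  = all k l<k k≤r
  ... | inj₂ refl = t

  runTo-step : ∀ {L k} → InT L (suc (suc k)) → Dec (InT L (suc k)) → (InT L (suc k) → RunTo L (suc k)) →
    RunTo L (suc (suc k))
  runTo-step {k = k} t (no ¬t) _ = suc (suc k) , s≤s z≤n , ℕP.≤-refl , single t , inj₂ ¬t
  runTo-step t (yes t′) rec with rec t′
  ... | (l , 1≤l , l≤k , all , edge) = l , 1≤l , ℕP.m≤n⇒m≤1+n l≤k , extendRight all t , edge

  runTo : ∀ L k → InT L k → RunTo L k
  runTo L zero          t = ⊥-elim (ℕP.<-irrefl refl (proj₁ (proj₂ (typed-inside t))))
  runTo L (suc zero)    t = 1 , s≤s z≤n , ℕP.≤-refl , single t , inj₁ refl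
  runTo L (suc (suc k)) t = runTo-step t (typed? L (suc k)) (runTo L (suc k))

  runFrom-step : ∀ {L k} → InT L k → k ≤ suc n → Dec (InT L (suc k)) → (InT L (suc k) → RunFrom L (suc k)) →
    RunFrom L k
  runFrom-step {k = k} t k≤n+1 (no ¬t) _ = k , ℕP.≤-refl , k≤n+1 , single t , inj₂ ¬t
  runFrom-step t k≤n+1 (yes t′) rec with rec t′
  ... | (r , k<r , r≤n+1 , all , edge) = r , ℕP.<⇒≤ k<r , r≤n+1 , extendLeft t all , edge

  -- m = n + 1 − k bounds the number of steps to the right boundary.
  runFrom′ : ∀ L m k → m ℕ.+ k ≡ suc n → InT L k → RunFrom L k
  runFrom′ L zero    k e t = k , ℕP.≤-refl , ℕP.≤-reflexive e , single t , inj₁ e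
  runFrom′ L (suc m) k e t = runFrom-step t (subst (k ≤_) e (ℕP.m≤n+m k (suc m))) (typed? L (suc k))
    (runFrom′ L m (suc k) (trans (ℕP.+-suc m k) e))

  runFrom : ∀ L k → InT L k → RunFrom L k
  runFrom L k t = runFrom′ L (suc n ∸ k) k (ℕP.m∸n+n≡m (proj₂ (proj₂ (typed-inside t)))) t

  far-end : ∀ {L k} → InT L k → ¬ InT L (suc k) → k ≤ n → SegFar L k
  far-end {L} {k} t ¬t k≤n with runTo L k t
  ... | (l , 1≤l , l≤k , all , edge) =
    l , (1≤l , l≤k , ℕP.m≤n⇒m≤1+n k≤n , all , edge , inj₂ ¬t) , λ (_ , k≡n+1) → ℕP.<-irrefl k≡n+1 (s≤s k≤n)

  near-end : ∀ {L k} → 1 ≤ k → InT L (suc k) → ¬ InT L k → SegNear L (suc k)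
  near-end {L} {k} 1≤k t ¬t with runFrom L (suc k) t
  ... | (r , k<r , r≤n+1 , all , edge) =
    r , (s≤s z≤n , k<r , r≤n+1 , all , inj₂ ¬t , edge) , λ (k+1≡1 , _) → ℕP.<-irrefl (sym k+1≡1) (s≤s 1≤k)

  far-typed : ∀ {L k} → SegFar L k → InT L k
  far-typed (l , (_ , l≤k , _ , all , _ , _) , _) = all _ l≤k ℕP.≤-refl

  far-next-untyped : ∀ {L k} → SegFar L k → k ≤ n → ¬ InT L (suc k)
  far-next-untyped (_ , (_ , _ , _ , _ , _ , inj₁ k≡n+1) , _) k≤n = ⊥-elim (ℕP.<-irrefl k≡n+1 (s≤s k≤n))
  far-next-untyped (_ , (_ , _ , _ , _ , _ , inj₂ ¬t) , _) k≤n = ¬t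

  far-positive : ∀ {L k} → SegFar L k → 1 ≤ k
  far-positive (l , (1≤l , l≤k , _) , _) = ℕP.≤-trans 1≤l l≤k

  near-typed : ∀ {L k} → SegNear L k → InT L k
  near-typed (r , (_ , k≤r , _ , all , _) , _) = all _ ℕP.≤-refl k≤r

  near-prev-untyped : ∀ {L k} → SegNear L (suc k) → 1 ≤ k → ¬ InT L k
  near-prev-untyped (_ , (_ , _ , _ , _ , inj₁ k+1≡1 , _) , _) 1≤k = ⊥-elim (ℕP.<-irrefl (sym k+1≡1) (s≤s 1≤k))
  near-prev-untyped (_ , (_ , _ , _ , _ , inj₂ ¬t , _) , _) 1≤k = ¬t

  near-bounded : ∀ {L k} → SegNear L (suc k) → k ≤ n
  near-bounded (_ , (_ , k<r , r≤n+1 , _) , _) = s≤s⁻¹ (ℕP.≤-trans k<r r≤n+1)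

module DownPaths (n : ℕ) (π : Word) (o : Orient) (T : Point → Set) (Sq : ℕ → ℕ → Set)
  (R : LineRule n (λ L k → T (pt o L k)) (SqAt o Sq) down)
  (sq⇒filled : ∀ {L k} → SqAt o Sq L k → PathConstruction.FilledAt n π o T L k)
  (filled-unique : ∀ {L L′ k} → PathConstruction.FilledAt n π o T L k → SqAt o Sq L′ k → L ≡ L′) where

  open PathConstruction n π o T
  open LineRule R
  open Segments n π o T typed-inside typed?

  square-corners : ∀ {L k} → SqAt o Sq L k → InT L k × ¬ InT L (suc k) × ¬ InT (suc L) k × InT (suc L) (suc k)
  square-corners {zero} sq = ⊥-elim (ℕP.<-irrefl refl (proj₁ (proj₁ (square-inside sq))))
  square-corners {suc L} {k} sq with square-below L k sq (λ sq′ → n≢1+n (square-unique sq′ sq))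
                                   | square-above (suc L) k sq (λ sq′ → n≢1+n (square-unique sq sq′))
  ... | (t , ¬t′) | (¬t″ , t‴) = t , ¬t′ , ¬t″ , t‴

  leaving⇒square : ∀ {L k} → k ≤ n → InT L k → ¬ InT L (suc k) → SqAt o Sq L k
  leaving⇒square {zero} k≤n t ¬t = ⊥-elim (ℕP.<-irrefl refl (proj₁ (proj₁ (typed-inside t))))
  leaving⇒square {suc L} {k} k≤n t ¬t with square? (suc L) k | square? L k
  ... | yes sq | _       = sq
  ... | no ¬sq | yes sq′ = ⊥-elim (proj₁ (square-above L k sq′ ¬sq) t)
  ... | no ¬sq | no ¬sq′ = ⊥-elim (¬t (proj₁ (no-square L k L≤n 1≤k k≤n ¬sq′ ¬sq) t))
    where
      L≤n = s≤s⁻¹ (proj₂ (proj₁ (typed-inside t)))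
      1≤k = proj₁ (proj₂ (typed-inside t))

  joining⇒square : ∀ {L k} → 1 ≤ k → k ≤ n → ¬ InT (suc L) k → InT (suc L) (suc k) → SqAt o Sq L k
  joining⇒square {L} {k} 1≤k k≤n ¬t t with square? L k | square? (suc L) k
  ... | yes sq | _       = sq
  ... | no ¬sq | yes sq′ = ⊥-elim (¬t (proj₁ (square-below L k sq′ ¬sq)))
  ... | no ¬sq | no ¬sq′ = ⊥-elim (¬t (proj₂ (no-square L k L≤n 1≤k k≤n ¬sq ¬sq′) t))
    where L≤n = s≤s⁻¹ (proj₂ (proj₁ (typed-inside t)))

  far-end-square : ∀ {L k} → SegFar L k → k ≤ n → SqAt o Sq L k
  far-end-square far k≤n = leaving⇒square k≤n (far-typed far) (far-next-untyped far k≤n)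

  -- The far end forces the square below it, ⟨L + 1 , k⟩, into the column of the filled ⟨L , k⟩.
  no-diagUp : ∀ {L k} → SegFar (suc L) k → SegNear L (suc k) → FilledAt L k → ⊥
  no-diagUp far near filled = n≢1+n (filled-unique filled (far-end-square far (near-bounded near)))

  edgeIsStep : ∀ u v → Edge u v → Step o Sq down u v
  edgeIsStep _ _ (straight L k _ _ _ t′)  = strD L k (λ sq → proj₁ (proj₂ (square-corners sq)) t′)
  edgeIsStep _ _ (diagDown L k far near _) = diagD L k (far-end-square far (near-bounded near))
  edgeIsStep _ _ (diagUp L k far near f)   = ⊥-elim (no-diagUp far near f)

  successor-at : ∀ L k → InT L k → k ≤ n → ∃ λ v → Edge (pt o L k) v
  successor-at L k t k≤n with typed? L (suc k)
  ... | yes t′ = pt o L (suc k) , straight L k (proj₁ (proj₁ (typed-inside t))) (proj₂ (proj₁ (typed-inside t))) t t′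
  ... | no ¬t′ = pt o (suc L) (suc k) ,
      diagDown L k (far-end t ¬t′ k≤n) (near-end (proj₁ (proj₂ (typed-inside t))) below-right below-left) (sq⇒filled sq)
    where
      sq = leaving⇒square k≤n t ¬t′
      below-left = proj₁ (proj₂ (proj₂ (square-corners sq)))
      below-right = proj₂ (proj₂ (proj₂ (square-corners sq)))

  predecessor-at : ∀ L k → InT L k → 2 ≤ k → ∃ λ u → Edge u (pt o L k)
  predecessor-at L (suc k) t (s≤s 1≤k) with typed? L k
  ... | yes t′ = pt o L k , straight L k (proj₁ (proj₁ (typed-inside t))) (proj₂ (proj₁ (typed-inside t))) t′ t
  predecessor-at zero (suc k) t (s≤s 1≤k) | no ¬t′ = ⊥-elim (ℕP.<-irrefl refl (proj₁ (proj₁ (typed-inside t))))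
  predecessor-at (suc L) (suc k) t (s≤s 1≤k) | no ¬t′ =
      pt o L k , diagDown L k (far-end above-left above-right′ k≤n) (near-end 1≤k t ¬t′) (sq⇒filled sq)
    where
      k≤n = s≤s⁻¹ (proj₂ (proj₂ (typed-inside t)))
      sq = joining⇒square 1≤k k≤n ¬t′ t
      above-left = proj₁ (square-corners sq)
      above-right′ = proj₁ (proj₂ (square-corners sq))

  successor : ∀ u → T u → along o u ≤ n → ∃ λ v → Edge u v
  successor u t a with pt-surjective o u
  ... | (L , k , refl) = successor-at L k t (subst (_≤ n) (along-pt o L k) a)

  predecessor : ∀ v → T v → 2 ≤ along o v → ∃ λ u → Edge u v
  predecessor v t a with pt-surjective o v
  ... | (L , k , refl) = predecessor-at L k t (subst (2 ≤_) (along-pt o L k) a)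

  same-source : ∀ {u v u′ v′} → Edge u v → Edge u′ v′ → u ≡ u′ → v ≡ v′
  same-source (straight _ _ _ _ _ _) (straight _ _ _ _ _ _) eq with pt-injective o eq
  ... | (refl , refl) = refl
  same-source (straight _ _ _ _ _ t′) (diagDown _ _ far near _) eq with pt-injective o eq
  ... | (refl , refl) = ⊥-elim (far-next-untyped far (near-bounded near) t′)
  same-source (diagDown _ _ far near _) (straight _ _ _ _ _ t′) eq with pt-injective o eq
  ... | (refl , refl) = ⊥-elim (far-next-untyped far (near-bounded near) t′)
  same-source (diagDown _ _ _ _ _) (diagDown _ _ _ _ _) eq with pt-injective o eq
  ... | (refl , refl) = refl
  same-source (diagUp _ _ far near f) _ _ = ⊥-elim (no-diagUp far near f)
  same-source _ (diagUp _ _ far near f) _ = ⊥-elim (no-diagUp far near f)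

  same-target : ∀ {u v u′ v′} → Edge u v → Edge u′ v′ → v ≡ v′ → u ≡ u′
  same-target (straight _ _ _ _ _ _) (straight _ _ _ _ _ _) eq with pt-injective o eq
  ... | (refl , refl) = refl
  same-target (straight _ _ _ _ t _) (diagDown _ _ far near _) eq with pt-injective o eq
  ... | (refl , refl) = ⊥-elim (near-prev-untyped near (far-positive far) t)
  same-target (diagDown _ _ far near _) (straight _ _ _ _ t _) eq with pt-injective o eq
  ... | (refl , refl) = ⊥-elim (near-prev-untyped near (far-positive far) t)
  same-target (diagDown _ _ _ _ _) (diagDown _ _ _ _ _) eq with pt-injective o eq
  ... | (refl , refl) = refl
  same-target (diagUp _ _ far near f) _ _ = ⊥-elim (no-diagUp far near f)
  same-target _ (diagUp _ _ far near f) _ = ⊥-elim (no-diagUp far near f)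

module UpPaths (n : ℕ) (π : Word) (o : Orient) (T : Point → Set) (Sq : ℕ → ℕ → Set)
  (R : LineRule n (λ L k → T (pt o L k)) (SqAt o Sq) up)
  (sq⇒filled : ∀ {L k} → SqAt o Sq L k → PathConstruction.FilledAt n π o T L k)
  (filled-unique : ∀ {L L′ k} → PathConstruction.FilledAt n π o T L k → SqAt o Sq L′ k → L ≡ L′) where

  open PathConstruction n π o T
  open LineRule R
  open Segments n π o T typed-inside typed?

  square-corners : ∀ {L k} → SqAt o Sq L k → InT (suc L) k × ¬ InT (suc L) (suc k) × ¬ InT L k × InT L (suc k)
  square-corners {zero} sq = ⊥-elim (ℕP.<-irrefl refl (proj₁ (proj₁ (square-inside sq))))
  square-corners {suc L} {k} sq with square-above (suc L) k sq (λ sq′ → n≢1+n (square-unique sq sq′))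
                                   | square-below L k sq (λ sq′ → n≢1+n (square-unique sq′ sq))
  ... | (t , ¬t′) | (¬t″ , t‴) = t , ¬t′ , ¬t″ , t‴

  leaving⇒square : ∀ {L k} → k ≤ n → InT (suc L) k → ¬ InT (suc L) (suc k) → SqAt o Sq L k
  leaving⇒square {L} {k} k≤n t ¬t with square? L k | square? (suc L) k
  ... | yes sq | _       = sq
  ... | no ¬sq | yes sq′ = ⊥-elim (proj₁ (square-below L k sq′ ¬sq) t)
  ... | no ¬sq | no ¬sq′ = ⊥-elim (¬t (proj₁ (no-square L k L≤n 1≤k k≤n ¬sq ¬sq′) t))
    where
      L≤n = s≤s⁻¹ (proj₂ (proj₁ (typed-inside t)))
      1≤k = proj₁ (proj₂ (typed-inside t))

  joining⇒square : ∀ {L k} → 1 ≤ k → k ≤ n → ¬ InT L k → InT L (suc k) → SqAt o Sq L k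
  joining⇒square {zero} 1≤k k≤n ¬t t = ⊥-elim (ℕP.<-irrefl refl (proj₁ (proj₁ (typed-inside t))))
  joining⇒square {suc L} {k} 1≤k k≤n ¬t t with square? (suc L) k | square? L k
  ... | yes sq | _       = sq
  ... | no ¬sq | yes sq′ = ⊥-elim (¬t (proj₁ (square-above L k sq′ ¬sq)))
  ... | no ¬sq | no ¬sq′ = ⊥-elim (¬t (proj₂ (no-square L k L≤n 1≤k k≤n ¬sq′ ¬sq) t))
    where L≤n = s≤s⁻¹ (proj₂ (proj₁ (typed-inside t)))

  near-end-square : ∀ {L k} → SegNear L (suc k) → 1 ≤ k → SqAt o Sq L k
  near-end-square near 1≤k = joining⇒square 1≤k (near-bounded near) (near-prev-untyped near 1≤k) (near-typed near)

  -- The near end forces the square above it, ⟨L + 1 , k⟩, into the column of the filled ⟨L , k⟩.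
  no-diagDown : ∀ {L k} → SegFar L k → SegNear (suc L) (suc k) → FilledAt L k → ⊥
  no-diagDown far near filled = n≢1+n (filled-unique filled (near-end-square near (far-positive far)))

  edgeIsStep : ∀ u v → Edge u v → Step o Sq up u v
  edgeIsStep _ _ (straight L k _ _ _ t′) =
    strU L k (λ L′ eq sq → proj₁ (proj₂ (square-corners sq)) (subst (λ z → InT z (suc k)) eq t′))
  edgeIsStep _ _ (diagDown L k far near f) = ⊥-elim (no-diagDown far near f)
  edgeIsStep _ _ (diagUp L k far near f) = diagU L k (leaving⇒square k≤n (far-typed far) (far-next-untyped far k≤n))
    where k≤n = near-bounded near

  successor-at : ∀ L k → InT L k → k ≤ n → ∃ λ v → Edge (pt o L k) v
  successor-at L k t k≤n with typed? L (suc k)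
  ... | yes t′ = pt o L (suc k) , straight L k (proj₁ (proj₁ (typed-inside t))) (proj₂ (proj₁ (typed-inside t))) t t′
  successor-at zero k t k≤n | no ¬t′ = ⊥-elim (ℕP.<-irrefl refl (proj₁ (proj₁ (typed-inside t))))
  successor-at (suc L) k t k≤n | no ¬t′ = pt o L (suc k) ,
      diagUp L k (far-end t ¬t′ k≤n) (near-end (proj₁ (proj₂ (typed-inside t))) above-right above-left) (sq⇒filled sq)
    where
      sq = leaving⇒square k≤n t ¬t′
      above-left = proj₁ (proj₂ (proj₂ (square-corners sq)))
      above-right = proj₂ (proj₂ (proj₂ (square-corners sq)))

  predecessor-at : ∀ L k → InT L k → 2 ≤ k → ∃ λ u → Edge u (pt o L k)
  predecessor-at L (suc k) t (s≤s 1≤k) with typed? L k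
  ... | yes t′ = pt o L k , straight L k (proj₁ (proj₁ (typed-inside t))) (proj₂ (proj₁ (typed-inside t))) t′ t
  ... | no ¬t′ = pt o (suc L) k , diagUp L k (far-end below-left below-right′ k≤n) (near-end 1≤k t ¬t′) (sq⇒filled sq)
    where
      k≤n = s≤s⁻¹ (proj₂ (proj₂ (typed-inside t)))
      sq = joining⇒square 1≤k k≤n ¬t′ t
      below-left = proj₁ (square-corners sq)
      below-right′ = proj₁ (proj₂ (square-corners sq))

  successor : ∀ u → T u → along o u ≤ n → ∃ λ v → Edge u v
  successor u t a with pt-surjective o u
  ... | (L , k , refl) = successor-at L k t (subst (_≤ n) (along-pt o L k) a)

  predecessor : ∀ v → T v → 2 ≤ along o v → ∃ λ u → Edge u v
  predecessor v t a with pt-surjective o v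
  ... | (L , k , refl) = predecessor-at L k t (subst (2 ≤_) (along-pt o L k) a)

  same-source : ∀ {u v u′ v′} → Edge u v → Edge u′ v′ → u ≡ u′ → v ≡ v′
  same-source (straight _ _ _ _ _ _) (straight _ _ _ _ _ _) eq with pt-injective o eq
  ... | (refl , refl) = refl
  same-source (straight _ _ _ _ _ t′) (diagUp _ _ far near _) eq with pt-injective o eq
  ... | (refl , refl) = ⊥-elim (far-next-untyped far (near-bounded near) t′)
  same-source (diagUp _ _ far near _) (straight _ _ _ _ _ t′) eq with pt-injective o eq
  ... | (refl , refl) = ⊥-elim (far-next-untyped far (near-bounded near) t′)
  same-source (diagUp _ _ _ _ _) (diagUp _ _ _ _ _) eq with pt-injective o eq
  ... | (refl , refl) = refl
  same-source (diagDown _ _ far near f) _ _ = ⊥-elim (no-diagDown far near f)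
  same-source _ (diagDown _ _ far near f) _ = ⊥-elim (no-diagDown far near f)

  same-target : ∀ {u v u′ v′} → Edge u v → Edge u′ v′ → v ≡ v′ → u ≡ u′
  same-target (straight _ _ _ _ _ _) (straight _ _ _ _ _ _) eq with pt-injective o eq
  ... | (refl , refl) = refl
  same-target (straight _ _ _ _ t _) (diagUp _ _ far near _) eq with pt-injective o eq
  ... | (refl , refl) = ⊥-elim (near-prev-untyped near (far-positive far) t)
  same-target (diagUp _ _ far near _) (straight _ _ _ _ t _) eq with pt-injective o eq
  ... | (refl , refl) = ⊥-elim (near-prev-untyped near (far-positive far) t)
  same-target (diagUp _ _ _ _ _) (diagUp _ _ _ _ _) eq with pt-injective o eq
  ... | (refl , refl) = refl
  same-target (diagDown _ _ far near f) _ _ = ⊥-elim (no-diagDown far near f)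
  same-target _ (diagDown _ _ far near f) _ = ⊥-elim (no-diagDown far near f)

pathsHaveShape : ∀ n π s o p dir Sq →
  LineRule n (λ L k → TypePt n π s o p (pt o L k)) (SqAt o Sq) dir →
  (∀ {L k} → SqAt o Sq L k → PathConstruction.FilledAt n π o (TypePt n π s o p) L k) →
  (∀ {L L′ k} → PathConstruction.FilledAt n π o (TypePt n π s o p) L k → SqAt o Sq L′ k → L ≡ L′) →
  PathsHaveShape n π s o p dir Sq
pathsHaveShape n π s o p down Sq R sq⇒filled filled-unique = record
  { edgeIsStep  = edgeIsStep
  ; successor   = successor
  ; predecessor = predecessor
  ; noSplit     = λ u v v′ e e′ → same-source e e′ refl
  ; noMerge     = λ u u′ v e e′ → same-target e e′ refl
  }
  where open DownPaths n π o (TypePt n π s o p) Sq R sq⇒filled filled-unique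
pathsHaveShape n π s o p up Sq R sq⇒filled filled-unique = record
  { edgeIsStep  = edgeIsStep
  ; successor   = successor
  ; predecessor = predecessor
  ; noSplit     = λ u v v′ e e′ → same-source e e′ refl
  ; noMerge     = λ u u′ v e e′ → same-target e e′ refl
  }
  where open UpPaths n π o (TypePt n π s o p) Sq R sq⇒filled filled-unique

-- Inversion commutes with insertion

entry-map : ∀ (f : ℤ → ℤ) → f 0ℤ ≡ 0ℤ → ∀ w r → entry (map f w) r ≡ f (entry w r)
entry-map f f0 []       r             = sym f0
entry-map f f0 (x ∷ xs) zero          = sym f0
entry-map f f0 (x ∷ xs) (suc zero)    = refl
entry-map f f0 (x ∷ xs) (suc (suc r)) = entry-map f f0 xs (suc r)

entry-ext : ∀ xs ys → length xs ≡ length ys → (∀ r → 1 ≤ r → r ≤ length xs → entry xs r ≡ entry ys r) → xs ≡ ys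
entry-ext []       []       _ _ = refl
entry-ext (x ∷ xs) (y ∷ ys) e h =
  cong₂ _∷_ (h 1 (s≤s z≤n) (s≤s z≤n))
    (entry-ext xs ys (ℕP.suc-injective e) λ { zero () _ ; (suc r) _ r≤ → h (suc (suc r)) (s≤s z≤n) (s≤s r≤) })

entry-applyUpTo : ∀ (g : ℕ → ℤ) m c → c < m → entry (applyUpTo g m) (suc c) ≡ g c
entry-applyUpTo g (suc m) zero    _       = refl
entry-applyUpTo g (suc m) (suc c) (s≤s h) = entry-applyUpTo (g ∘ suc) m c h

length-invB : ∀ w → length (invB w) ≡ length w
length-invB w = trans (length-map _ (upTo (length w))) (length-upTo (length w))

entry-invB : ∀ w c → 1 ≤ c → c ≤ length w → entry (invB w) c ≡ invAt c 1 w
entry-invB w (suc c) _ c≤ =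
  trans (cong (λ z → entry z (suc c)) (map-applyUpTo id (λ k → invAt (suc k) 1 w) (length w)))
        (entry-applyUpTo (λ k → invAt (suc k) 1 w) (length w) c c≤)

≡⇒≡ᵇ≡true : ∀ m n → m ≡ n → (m ≡ᵇ n) ≡ true
≡⇒≡ᵇ≡true m n = Equivalence.to T-≡ ∘ ℕP.≡⇒≡ᵇ m n

≢⇒≡ᵇ≡false : ∀ m n → m ≢ n → (m ≡ᵇ n) ≡ false
≢⇒≡ᵇ≡false m n m≢n = ¬T⇒≡false (m≢n ∘ ℕP.≡ᵇ⇒≡ m n)

invAt-first : ∀ c pos w r → 1 ≤ r → r ≤ length w → ∣ entry w r ∣ ≡ c →
  (∀ r′ → 1 ≤ r′ → r′ < r → ∣ entry w r′ ∣ ≢ c) →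
  invAt c pos w ≡ signTimes (entry w r) (pos ℕ.+ (r ∸ 1))
invAt-first c pos (x ∷ xs) (suc zero) _ _ e _ rewrite ≡⇒≡ᵇ≡true ∣ x ∣ c e | ℕP.+-identityʳ pos = refl
invAt-first c pos (x ∷ xs) (suc (suc r)) _ (s≤s r≤) e earlier
  rewrite ≢⇒≡ᵇ≡false ∣ x ∣ c (earlier 1 (s≤s z≤n) (s≤s (s≤s z≤n))) =
  trans (invAt-first c (suc pos) xs (suc r) (s≤s z≤n) r≤ e
          λ { zero () _ ; (suc r′) _ r′< → earlier (suc (suc r′)) (s≤s z≤n) (s≤s r′<) })
        (cong (signTimes (entry xs (suc r))) (sym (ℕP.+-suc pos r)))

module _ (i : ℕ) (v : ℤ) where

  entry-insertAt-before : ∀ w r → i ≤ length w → r ≤ i → entry (insertAt (suc i) v w) r ≡ entry w r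
  entry-insertAt-before w zero _ _ = trans (entry-zero (insertAt (suc i) v w)) (sym (entry-zero w))
  entry-insertAt-before w (suc r) i≤ r≤ = go i w r i≤ r≤
    where
      go : ∀ i w r → i ≤ length w → suc r ≤ i → entry (take i w ++ v ∷ drop i w) (suc r) ≡ entry w (suc r)
      go (suc i) (x ∷ xs) zero    _       _       = refl
      go (suc i) (x ∷ xs) (suc r) (s≤s h) (s≤s r<) = go i xs r h r<

  entry-insertAt-at : ∀ w → i ≤ length w → entry (insertAt (suc i) v w) (suc i) ≡ v
  entry-insertAt-at w = go i w
    where
      go : ∀ i w → i ≤ length w → entry (take i w ++ v ∷ drop i w) (suc i) ≡ v
      go zero    w        _       = refl
      go (suc i) (x ∷ xs) (s≤s h) = go i xs h

  entry-insertAt-after : ∀ w r → i ≤ length w → suc i ≤ r → entry (insertAt (suc i) v w) (suc r) ≡ entry w r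
  entry-insertAt-after w r = go i w r
    where
      go : ∀ i w r → i ≤ length w → suc i ≤ r → entry (take i w ++ v ∷ drop i w) (suc r) ≡ entry w r
      go zero    w        (suc r)       _       _        = refl
      go (suc i) (x ∷ xs) (suc (suc r)) (s≤s h) (s≤s i<r) = go i xs (suc r) h i<r

  length-insertAt : ∀ w → i ≤ length w → length (insertAt (suc i) v w) ≡ suc (length w)
  length-insertAt w = go i w
    where
      go : ∀ i w → i ≤ length w → length (take i w ++ v ∷ drop i w) ≡ suc (length w)
      go zero    w        _       = refl
      go (suc i) (x ∷ xs) (s≤s h) = cong suc (go i xs h)

-- The order-preserving bijection from ℕ onto ℕ ∖ {i}, as Data.Fin.punchIn.
punchIn : ℕ → ℕ → ℕ
punchIn i r = if r ℕ.<ᵇ i then r else suc r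

punchIn-< : ∀ {i r} → r < i → punchIn i r ≡ r
punchIn-< {i} {r} r<i rewrite ≤⇒≤ᵇ≡true {suc r} {i} r<i = refl

punchIn-≥ : ∀ {i r} → i ≤ r → punchIn i r ≡ suc r
punchIn-≥ {i} {r} i≤r rewrite >⇒≤ᵇ≡false {suc r} {i} (s≤s i≤r) = refl

punchIn-injective : ∀ i a b → punchIn i a ≡ punchIn i b → a ≡ b
punchIn-injective i a b e with ℕP.<-≤-connex a i | ℕP.<-≤-connex b i
... | inj₁ a<i | inj₁ b<i rewrite punchIn-< a<i | punchIn-< b<i = e
... | inj₁ a<i | inj₂ i≤b rewrite punchIn-< a<i | punchIn-≥ i≤b =
  ⊥-elim (ℕP.<-irrefl refl (ℕP.<-≤-trans a<i (ℕP.≤-trans i≤b (ℕP.≤-trans (ℕP.n≤1+n b) (ℕP.≤-reflexive (sym e))))))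
... | inj₂ i≤a | inj₁ b<i rewrite punchIn-≥ i≤a | punchIn-< b<i =
  ⊥-elim (ℕP.<-irrefl refl (ℕP.<-≤-trans b<i (ℕP.≤-trans i≤a (ℕP.≤-trans (ℕP.n≤1+n a) (ℕP.≤-reflexive e)))))
... | inj₂ i≤a | inj₂ i≤b rewrite punchIn-≥ i≤a | punchIn-≥ i≤b = ℕP.suc-injective e

punchIn≢ : ∀ i a → punchIn i a ≢ i
punchIn≢ i a e with ℕP.<-≤-connex a i
... | inj₁ a<i rewrite punchIn-< a<i = ℕP.<-irrefl e a<i
... | inj₂ i≤a rewrite punchIn-≥ i≤a = ℕP.<-irrefl (sym e) (s≤s i≤a)

punchIn-surjective : ∀ n i c → 1 ≤ i → i ≤ suc n → 1 ≤ c → c ≤ suc n → c ≢ i →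
  ∃ λ c′ → 1 ≤ c′ × c′ ≤ n × punchIn i c′ ≡ c
punchIn-surjective n i c 1≤i i≤n+1 1≤c c≤n+1 c≢i with ℕP.<-cmp c i
... | tri< c<i _ _ = c , 1≤c , s≤s⁻¹ (ℕP.<-≤-trans c<i i≤n+1) , punchIn-< c<i
... | tri≈ _ c≡i _ = ⊥-elim (c≢i c≡i)
punchIn-surjective n i (suc c) 1≤i i≤n+1 1≤c c≤n+1 c≢i | tri> _ _ i<c =
  c , ℕP.≤-trans 1≤i (s≤s⁻¹ i<c) , s≤s⁻¹ c≤n+1 , punchIn-≥ (s≤s⁻¹ i<c)

punchIn-bounded : ∀ n i c → 1 ≤ c → c ≤ n → 1 ≤ punchIn i c × punchIn i c ≤ suc n
punchIn-bounded n i c 1≤c c≤n with ℕP.<-≤-connex c i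
... | inj₁ c<i rewrite punchIn-< c<i = 1≤c , ℕP.m≤n⇒m≤1+n c≤n
... | inj₂ i≤c rewrite punchIn-≥ i≤c = s≤s z≤n , s≤s c≤n

∣shift∣ : ∀ j′ x → ∣ shift (suc j′) x ∣ ≡ punchIn (suc j′) ∣ x ∣
∣shift∣ j′ (+ m) with shift-+ (suc j′) m
... | inj₁ (m<j , e) rewrite e | punchIn-< m<j = refl
... | inj₂ (j≤m , e) rewrite e | punchIn-≥ j≤m = refl
∣shift∣ j′ -[1+ m ] with shift-− (suc j′) m
... | inj₁ (m<j , e) rewrite e | punchIn-< m<j = refl
... | inj₂ (j≤m , e) rewrite e | punchIn-≥ j≤m = refl

signTimes-shift : ∀ j x r → signTimes (shift j x) r ≡ signTimes x r
signTimes-shift j (+ m) r with shift-+ j m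
... | inj₁ (_ , e) rewrite e = refl
... | inj₂ (_ , e) rewrite e = refl
signTimes-shift j -[1+ m ] r with shift-− j m
... | inj₁ (_ , e) rewrite e = refl
... | inj₂ (_ , e) rewrite e = refl

shift-signTimes : ∀ i x r → 1 ≤ r → shift i (signTimes x r) ≡ signTimes x (punchIn i r)
shift-signTimes i x (suc r) _ with x ℤ.≤ᵇ - (+ 1)
... | false with shift-+ i (suc r)
...   | inj₁ (r<i , e) rewrite e | punchIn-< r<i = refl
...   | inj₂ (i≤r , e) rewrite e | punchIn-≥ i≤r = refl
shift-signTimes i x (suc r) _ | true with shift-− i r
...   | inj₁ (r<i , e) rewrite e | punchIn-< r<i = refl
...   | inj₂ (i≤r , e) rewrite e | punchIn-≥ i≤r = refl

signTimes-signed : ∀ s j′ r → signTimes (signed s (suc j′)) r ≡ signed s r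
signTimes-signed plus  j′ r = refl
signTimes-signed minus j′ r = refl

∣signTimes∣ : ∀ x r → ∣ signTimes x r ∣ ≡ r
∣signTimes∣ x r with x ℤ.≤ᵇ - (+ 1)
∣signTimes∣ x zero    | true  = refl
∣signTimes∣ x (suc r) | true  = refl
... | false = refl

signTimes⇒signed : ∀ s x r c → 1 ≤ r → ∣ x ∣ ≡ c → signTimes x r ≡ signed s r → x ≡ signed s c
signTimes⇒signed plus  (+ m)    (suc r) c _ e _ = cong +_ e
signTimes⇒signed minus (+ m)    (suc r) c _ e ()
signTimes⇒signed plus  -[1+ m ] (suc r) c _ e ()
signTimes⇒signed minus -[1+ m ] (suc r) c _ e _ = cong (λ z → - (+ z)) e

∈⇒entry : ∀ {x : ℤ} {xs} → x ∈ xs → ∃ λ r → 1 ≤ r × r ≤ length xs × entry xs r ≡ x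
∈⇒entry (here refl) = 1 , s≤s z≤n , s≤s z≤n , refl
∈⇒entry {xs = y ∷ ys} (there x∈) with ∈⇒entry x∈
... | (suc r , _ , r≤ , e) = suc (suc r) , s≤s z≤n , s≤s r≤ , e

entry∈ : ∀ (xs : List ℤ) r → 1 ≤ r → r ≤ length xs → entry xs r ∈ xs
entry∈ (x ∷ xs) (suc zero)    _ _       = here refl
entry∈ (x ∷ xs) (suc (suc r)) _ (s≤s h) = there (entry∈ xs (suc r) (s≤s z≤n) h)

All-∣entry∣ : ∀ {P : ℕ → Set} (ys : List ℤ) → All P (map ∣_∣ ys) → ∀ r → 1 ≤ r → r ≤ length ys → P ∣ entry ys r ∣
All-∣entry∣ (y ∷ ys) (p ∷ _)  (suc zero)    _ _       = p
All-∣entry∣ (y ∷ ys) (_ ∷ ps) (suc (suc r)) _ (s≤s h) = All-∣entry∣ ys ps (suc r) (s≤s z≤n) h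

Unique-∣entry∣ : ∀ (xs : List ℤ) → Unique (map ∣_∣ xs) →
  ∀ r r′ → 1 ≤ r → r < r′ → r′ ≤ length xs → ∣ entry xs r ∣ ≢ ∣ entry xs r′ ∣
Unique-∣entry∣ (x ∷ xs) (_ ∷ _) (suc zero) (suc zero) _ (s≤s ()) _
Unique-∣entry∣ (x ∷ xs) (x∉ ∷ _) (suc zero) (suc (suc r′)) _ _ (s≤s h) = All-∣entry∣ xs x∉ (suc r′) (s≤s z≤n) h
Unique-∣entry∣ (x ∷ xs) (_ ∷ u) (suc (suc r)) (suc (suc r′)) _ (s≤s r<r′) (s≤s h) =
  Unique-∣entry∣ xs u (suc r) (suc r′) (s≤s z≤n) r<r′ h

Onto : ℕ → Word → Set
Onto n σ = ∀ c → 1 ≤ c → c ≤ n → ∃ λ r → 1 ≤ r × r ≤ n × ∣ entry σ r ∣ ≡ c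

module _ {n π} (P : IsSignedPerm n π) where

  length-signedPerm : length π ≡ n
  length-signedPerm =
    trans (sym (length-map ∣_∣ π)) (trans (↭-length P) (trans (length-map suc (upTo n)) (length-upTo n)))

  IsSignedPerm⇒entrywise : EntrywiseSignedPerm n π
  IsSignedPerm⇒entrywise = record { length≡ = length-signedPerm ; bounded = bounded ; injective = injective }
    where
      bounded : ∀ r → 1 ≤ r → r ≤ n → 1 ≤ ∣ entry π r ∣ × ∣ entry π r ∣ ≤ n
      bounded r 1≤r r≤n
        with ∈-map⁻ suc (∈-resp-↭ P (∈-map⁺ ∣_∣ (entry∈ π r 1≤r (subst (r ≤_) (sym length-signedPerm) r≤n))))
      ... | (m , m∈ , e) rewrite e = s≤s z≤n , ∈-upTo⁻ m∈

      unique : Unique (map ∣_∣ π)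
      unique = Unique-resp-↭ (↭⇒↭ₛ (↭-sym P)) (UniqueP.map⁺ ℕP.suc-injective (UniqueP.upTo⁺ n))

      injective : ∀ r r′ → 1 ≤ r → r ≤ n → 1 ≤ r′ → r′ ≤ n → ∣ entry π r ∣ ≡ ∣ entry π r′ ∣ → r ≡ r′
      injective r r′ 1≤r r≤n 1≤r′ r′≤n e with ℕP.<-cmp r r′
      ... | tri< r<r′ _ _ = ⊥-elim (Unique-∣entry∣ π unique r r′ 1≤r r<r′ (subst (r′ ≤_) (sym length-signedPerm) r′≤n) e)
      ... | tri≈ _ r≡r′ _ = r≡r′
      ... | tri> _ _ r′<r = ⊥-elim (Unique-∣entry∣ π unique r′ r 1≤r′ r′<r (subst (r ≤_) (sym length-signedPerm) r≤n) (sym e))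

  IsSignedPerm⇒onto : Onto n π
  IsSignedPerm⇒onto (suc m) _ c≤n with ∈-map⁻ ∣_∣ (∈-resp-↭ (↭-sym P) (∈-map⁺ suc (∈-upTo⁺ {n} {m} c≤n)))
  ... | (x , x∈ , e) with ∈⇒entry x∈
  ... | (r , 1≤r , r≤ , ex) = r , 1≤r , subst (r ≤_) length-signedPerm r≤ , trans (cong ∣_∣ ex) (sym e)

module Inverse {n π} (P : EntrywiseSignedPerm n π) (onto : Onto n π) where
  open EntrywiseSignedPerm P

  τ : Word
  τ = invB π

  entry-inverse : ∀ c → 1 ≤ c → c ≤ n →
    ∃ λ r → 1 ≤ r × r ≤ n × ∣ entry π r ∣ ≡ c × entry τ c ≡ signTimes (entry π r) r
  entry-inverse c 1≤c c≤n with onto c 1≤c c≤n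
  ... | (suc r′ , 1≤r , r≤n , e) = suc r′ , 1≤r , r≤n , e ,
    trans (entry-invB π c 1≤c (subst (c ≤_) (sym length≡) c≤n))
      (invAt-first c 1 π (suc r′) 1≤r (subst (suc r′ ≤_) (sym length≡) r≤n) e
        (λ r″ 1≤r″ r″<r e′ → ℕP.<-irrefl (injective r″ (suc r′) 1≤r″ (ℕP.≤-trans (ℕP.<⇒≤ r″<r) r≤n) 1≤r r≤n
                                                      (trans e′ (sym e))) r″<r))

  length-τ : length τ ≡ n
  length-τ = trans (length-invB π) length≡

  inverse-entrywise : EntrywiseSignedPerm n τ
  inverse-entrywise = record { length≡ = length-τ ; bounded = bounded-τ ; injective = injective-τ }
    where
      bounded-τ : ∀ c → 1 ≤ c → c ≤ n → 1 ≤ ∣ entry τ c ∣ × ∣ entry τ c ∣ ≤ n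
      bounded-τ c 1≤c c≤n with entry-inverse c 1≤c c≤n
      ... | (r , 1≤r , r≤n , _ , e) rewrite e | ∣signTimes∣ (entry π r) r = 1≤r , r≤n
      injective-τ : ∀ c c′ → 1 ≤ c → c ≤ n → 1 ≤ c′ → c′ ≤ n → ∣ entry τ c ∣ ≡ ∣ entry τ c′ ∣ → c ≡ c′
      injective-τ c c′ 1≤c c≤n 1≤c′ c′≤n ee with entry-inverse c 1≤c c≤n | entry-inverse c′ 1≤c′ c′≤n
      ... | (r , _ , _ , a , e) | (r′ , _ , _ , a′ , e′)
        rewrite e | e′ | ∣signTimes∣ (entry π r) r | ∣signTimes∣ (entry π r′) r′ | ee = trans (sym a) a′

  SignedSq-transpose : ∀ s r c → SignedSq s π r c → SignedSq s τ c r
  SignedSq-transpose s r c sq with SignedSq-inside {s} P sq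
  ... | ((1≤r , r≤n) , (1≤c , c≤n)) with entry-inverse c 1≤c c≤n
  ... | (r′ , 1≤r′ , r′≤n , a , e′) = 1≤r , (begin
    entry τ c                          ≡⟨ e′ ⟩
    signTimes (entry π r′) r′          ≡⟨ cong (λ z → signTimes (entry π z) z) (sym r≡r′) ⟩
    signTimes (entry π r) r            ≡⟨ cong (λ z → signTimes z r) (proj₂ sq) ⟩
    signTimes (signed s c) r           ≡⟨ signTimes-signed′ s c 1≤c ⟩
    signed s r                         ∎)
    where
      open ≡-Reasoning
      r≡r′ : r ≡ r′
      r≡r′ = injective r r′ 1≤r r≤n 1≤r′ r′≤n (trans (cong ∣_∣ (proj₂ sq)) (trans (∣signed∣ s c) (sym a)))
      signTimes-signed′ : ∀ s c → 1 ≤ c → signTimes (signed s c) r ≡ signed s r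
      signTimes-signed′ s (suc c′) _ = signTimes-signed s c′ r

  SignedSq-transpose⁻¹ : ∀ s r c → SignedSq s τ c r → SignedSq s π r c
  SignedSq-transpose⁻¹ s r c sq with SignedSq-inside {s} inverse-entrywise sq
  ... | ((1≤c , c≤n) , (1≤r , r≤n)) with entry-inverse c 1≤c c≤n
  ... | (r′ , _ , _ , a , e′) = 1≤c ,
    subst (λ z → entry π z ≡ signed s c) (sym r≡r′)
      (signTimes⇒signed s (entry π r′) r c 1≤r a
        (subst (λ z → signTimes (entry π r′) z ≡ signed s r) (sym r≡r′) (trans (sym e′) (proj₂ sq))))
    where
      r≡r′ : r ≡ r′
      r≡r′ = trans (sym (∣signed∣ s r)) (trans (cong ∣_∣ (sym (proj₂ sq))) (trans (cong ∣_∣ e′) (∣signTimes∣ (entry π r′) r′)))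

  -- σ = φ^s_{(i,j)}(π) and ρ = φ^s_{(j,i)}(τ); σ carries ±j at position i and
  -- ±shift(π_r) at position punchIn i r, and ρ is read off from this description of σ.
  module InsertionCommutes (s : InsSign) (i′ j′ : ℕ) (i′≤n : i′ ≤ n) (j′≤n : j′ ≤ n) where
    i = suc i′
    j = suc j′
    w = map (shift j) π
    σ = insertAt i (signed s j) w
    w′ = map (shift i) τ
    ρ = insertAt j (signed s i) w′

    i′≤∣w∣ : i′ ≤ length w
    i′≤∣w∣ = subst (i′ ≤_) (sym (trans (length-map _ π) length≡)) i′≤n

    j′≤∣w′∣ : j′ ≤ length w′
    j′≤∣w′∣ = subst (j′ ≤_) (sym (trans (length-map _ τ) length-τ)) j′≤n

    length-σ : length σ ≡ suc n
    length-σ = trans (length-insertAt i′ _ w i′≤∣w∣) (cong suc (trans (length-map _ π) length≡))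

    length-ρ : length ρ ≡ suc n
    length-ρ = trans (length-insertAt j′ _ w′ j′≤∣w′∣) (cong suc (trans (length-map _ τ) length-τ))

    σ-at-i : entry σ i ≡ signed s j
    σ-at-i = entry-insertAt-at i′ _ w i′≤∣w∣

    σ-at-punchIn : ∀ r → entry σ (punchIn i r) ≡ shift j (entry π r)
    σ-at-punchIn r with ℕP.<-≤-connex r i
    ... | inj₁ r<i rewrite punchIn-< r<i = trans (entry-insertAt-before i′ _ w r i′≤∣w∣ (s≤s⁻¹ r<i)) (entry-map (shift j) refl π r)
    ... | inj₂ i≤r rewrite punchIn-≥ i≤r = trans (entry-insertAt-after i′ _ w r i′≤∣w∣ i≤r) (entry-map (shift j) refl π r)

    ρ-at-punchIn : ∀ c → entry ρ (punchIn j c) ≡ entry w′ c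
    ρ-at-punchIn c with ℕP.<-≤-connex c j
    ... | inj₁ c<j rewrite punchIn-< c<j = entry-insertAt-before j′ _ w′ c j′≤∣w′∣ (s≤s⁻¹ c<j)
    ... | inj₂ j≤c rewrite punchIn-≥ j≤c = entry-insertAt-after j′ _ w′ c j′≤∣w′∣ j≤c

    position : ∀ r″ → 1 ≤ r″ → r″ ≤ suc n → r″ ≡ i ⊎ ∃ λ r → 1 ≤ r × r ≤ n × punchIn i r ≡ r″
    position r″ 1≤r″ r″≤n+1 with r″ ℕ.≟ i
    ... | yes r″≡i = inj₁ r″≡i
    ... | no  r″≢i = inj₂ (punchIn-surjective n i r″ (s≤s z≤n) (s≤s i′≤n) 1≤r″ r″≤n+1 r″≢i)

    ∣σ-at-punchIn∣ : ∀ r → ∣ entry σ (punchIn i r) ∣ ≡ punchIn j ∣ entry π r ∣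
    ∣σ-at-punchIn∣ r = trans (cong ∣_∣ (σ-at-punchIn r)) (∣shift∣ j′ (entry π r))

    OnlyAt : ℕ → ℕ → Set
    OnlyAt c r = ∀ r″ → 1 ≤ r″ → r″ ≤ suc n → ∣ entry σ r″ ∣ ≡ c → r″ ≡ r

    only-i-has-j : OnlyAt j i
    only-i-has-j r″ 1≤r″ r″≤n+1 e with position r″ 1≤r″ r″≤n+1
    ... | inj₁ r″≡i = r″≡i
    ... | inj₂ (r , _ , _ , refl) = ⊥-elim (punchIn≢ j ∣ entry π r ∣ (trans (sym (∣σ-at-punchIn∣ r)) e))

    only-punchIn : ∀ c r → 1 ≤ r → r ≤ n → ∣ entry π r ∣ ≡ c → punchIn j c ≢ j → OnlyAt (punchIn j c) (punchIn i r)
    only-punchIn c r 1≤r r≤n ∣πr∣≡c ≢j r″ 1≤r″ r″≤n+1 e with position r″ 1≤r″ r″≤n+1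
    ... | inj₁ refl = ⊥-elim (≢j (trans (sym e) (trans (cong ∣_∣ σ-at-i) (∣signed∣ s j))))
    ... | inj₂ (r‴ , 1≤r‴ , r‴≤n , refl) =
      cong (punchIn i) (injective r‴ r 1≤r‴ r‴≤n 1≤r r≤n
        (trans (punchIn-injective j _ _ (trans (sym (∣σ-at-punchIn∣ r‴)) e)) (sym ∣πr∣≡c)))

    none-before : ∀ {c r} → r ≤ suc n → OnlyAt c r → ∀ r″ → 1 ≤ r″ → r″ < r → ∣ entry σ r″ ∣ ≢ c
    none-before r≤n+1 only r″ 1≤r″ r″<r e = ℕP.<-irrefl (only r″ 1≤r″ (ℕP.≤-trans (ℕP.<⇒≤ r″<r) r≤n+1) e) r″<r

    invB-σ-at-j : entry (invB σ) j ≡ entry ρ j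
    invB-σ-at-j = begin
      entry (invB σ) j           ≡⟨ entry-invB σ j (s≤s z≤n) (subst (j ≤_) (sym length-σ) (s≤s j′≤n)) ⟩
      invAt j 1 σ                ≡⟨ invAt-first j 1 σ i (s≤s z≤n) (subst (i ≤_) (sym length-σ) (s≤s i′≤n))
                                      (trans (cong ∣_∣ σ-at-i) (∣signed∣ s j)) (none-before (s≤s i′≤n) only-i-has-j) ⟩
      signTimes (entry σ i) i    ≡⟨ cong (λ z → signTimes z i) σ-at-i ⟩
      signTimes (signed s j) i   ≡⟨ signTimes-signed s j′ i ⟩
      signed s i                 ≡⟨ entry-insertAt-at j′ _ w′ j′≤∣w′∣ ⟨
      entry ρ j                  ∎
      where open ≡-Reasoning

    invB-σ-at-punchIn : ∀ c → 1 ≤ c → c ≤ n → punchIn j c ≢ j → entry (invB σ) (punchIn j c) ≡ entry ρ (punchIn j c)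
    invB-σ-at-punchIn c 1≤c c≤n ≢j with entry-inverse c 1≤c c≤n
    ... | (r , 1≤r , r≤n , ∣πr∣≡c , τc) = begin
      entry (invB σ) (punchIn j c)
        ≡⟨ entry-invB σ (punchIn j c) (proj₁ c-inside) (subst (punchIn j c ≤_) (sym length-σ) (proj₂ c-inside)) ⟩
      invAt (punchIn j c) 1 σ
        ≡⟨ invAt-first (punchIn j c) 1 σ (punchIn i r) (proj₁ r-inside) (subst (punchIn i r ≤_) (sym length-σ) (proj₂ r-inside))
             (trans (∣σ-at-punchIn∣ r) (cong (punchIn j) ∣πr∣≡c))
             (none-before (proj₂ r-inside) (only-punchIn c r 1≤r r≤n ∣πr∣≡c ≢j)) ⟩
      signTimes (entry σ (punchIn i r)) (1 ℕ.+ (punchIn i r ∸ 1))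
        ≡⟨ cong₂ signTimes (σ-at-punchIn r) (ℕP.m+[n∸m]≡n (proj₁ r-inside)) ⟩
      signTimes (shift j (entry π r)) (punchIn i r)  ≡⟨ signTimes-shift j (entry π r) (punchIn i r) ⟩
      signTimes (entry π r) (punchIn i r)            ≡⟨ shift-signTimes i (entry π r) r 1≤r ⟨
      shift i (signTimes (entry π r) r)              ≡⟨ cong (shift i) τc ⟨
      shift i (entry τ c)                            ≡⟨ entry-map (shift i) refl τ c ⟨
      entry w′ c                                     ≡⟨ ρ-at-punchIn c ⟨
      entry ρ (punchIn j c)                          ∎
      where
        open ≡-Reasoning
        r-inside = punchIn-bounded n i r 1≤r r≤n
        c-inside = punchIn-bounded n j c 1≤c c≤n

    invB-σ≡ρ : invB σ ≡ ρ
    invB-σ≡ρ = entry-ext (invB σ) ρ (trans (length-invB σ) (trans length-σ (sym length-ρ)))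
      (λ c 1≤c c≤ → at c 1≤c (subst (c ≤_) (trans (length-invB σ) length-σ) c≤))
      where
        at : ∀ c → 1 ≤ c → c ≤ suc n → entry (invB σ) c ≡ entry ρ c
        at c 1≤c c≤n+1 with c ℕ.≟ j
        ... | yes refl = invB-σ-at-j
        ... | no c≢j with punchIn-surjective n j c (s≤s z≤n) (s≤s j′≤n) 1≤c c≤n+1 c≢j
        ... | (c′ , 1≤c′ , c′≤n , refl) = invB-σ-at-punchIn c′ 1≤c′ c′≤n c≢j

  invB-insertion : ∀ s i j → 1 ≤ i → i ≤ suc n → 1 ≤ j → j ≤ suc n → invB (insertion s i j π) ≡ insertion s j i τ
  invB-insertion s (suc i′) (suc j′) _ (s≤s i′≤n) _ (s≤s j′≤n) =
    trans (cong invB (insertion-≡ s (suc i′) (suc j′) π))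
      (trans (InsertionCommutes.invB-σ≡ρ s i′ j′ i′≤n j′≤n) (sym (insertion-≡ s (suc j′) (suc i′) τ)))

-- Horizontal and vertical paths

SignedSq-row-unique : ∀ {s s′ σ r c c′} → SignedSq s σ r c → SignedSq s′ σ r c′ → c ≡ c′
SignedSq-row-unique {s} {s′} {c = c} {c′} (_ , e) (_ , e′) =
  trans (sym (∣signed∣ s c)) (trans (cong ∣_∣ (sym e)) (trans (cong ∣_∣ e′) (∣signed∣ s′ c′)))

module _ {X X′ Y Y′ : Set} (f : X → X′) (f⁻¹ : X′ → X) (g : Y → Y′) (g⁻¹ : Y′ → Y) where

  AbovePattern-map : ∀ dir → AbovePattern dir X Y → AbovePattern dir X′ Y′
  AbovePattern-map down (¬x , y) = ¬x ∘ f⁻¹ , g y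
  AbovePattern-map up   (x , ¬y) = f x , ¬y ∘ g⁻¹

  BelowPattern-map : ∀ dir → BelowPattern dir X Y → BelowPattern dir X′ Y′
  BelowPattern-map down (x , ¬y) = f x , ¬y ∘ g⁻¹
  BelowPattern-map up   (¬x , y) = ¬x ∘ f⁻¹ , g y

LineRule-transfer : ∀ {n dir} {In In′ Sq Sq′ : ℕ → ℕ → Set} → LineRule n In Sq dir →
  (∀ {L k} → In L k → In′ L k) → (∀ {L k} → In′ L k → In L k) →
  (∀ {L k} → Sq L k → Sq′ L k) → (∀ {L k} → Sq′ L k → Sq L k) → LineRule n In′ Sq′ dir
LineRule-transfer {n} {dir} R f f⁻¹ g g⁻¹ = record
  { typed-inside  = typed-inside ∘ f⁻¹
  ; typed?        = λ L k → map′ f f⁻¹ (typed? L k)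
  ; square-inside = square-inside ∘ g⁻¹
  ; square?       = λ L k → map′ g g⁻¹ (square? L k)
  ; square-unique = λ sq sq′ → square-unique (g⁻¹ sq) (g⁻¹ sq′)
  ; square-above  = λ L k sq ¬sq → AbovePattern-map f f⁻¹ f f⁻¹ dir (square-above L k (g⁻¹ sq) (¬sq ∘ g))
  ; square-below  = λ L k sq ¬sq → BelowPattern-map f f⁻¹ f f⁻¹ dir (square-below L k (g⁻¹ sq) (¬sq ∘ g))
  ; no-square     = λ L k L≤n 1≤k k≤n ¬sq ¬sq′ →
      let (to , from) = no-square L k L≤n 1≤k k≤n (¬sq ∘ g) (¬sq′ ∘ g) in f ∘ to ∘ f⁻¹ , f ∘ from ∘ f⁻¹
  }
  where open LineRule R

module _ {n π} (P : IsSignedPerm n π) where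
  private
    E = IsSignedPerm⇒entrywise P
  open Inverse E (IsSignedPerm⇒onto P)

  horizontal : ∀ {s p dir} → Claimed s p dir → PathsHaveShape n π s horiz p dir (SignedSq s π)
  horizontal {s} {p} {dir} c = pathsHaveShape n π s horiz p dir (SignedSq s π) (horizontalRule E c)
    (SignedSq⇒Filled s {π})
    (λ {L} {_} {k} filled sq → let (s′ , sq′) = Filled⇒SignedSq {π} {L} {k} filled in
      SignedSq-column-unique {s′} {s} E sq′ sq)

  d-vert≡d-horiz-inverse : ∀ s k L → 1 ≤ k → k ≤ suc n → 1 ≤ L → L ≤ suc n → d π s vert k L ≡ d τ s horiz L k
  d-vert≡d-horiz-inverse s k L 1≤k k≤ 1≤L L≤ = cong (λ σ → desB σ ⊖ desB τ) (invB-insertion s k L 1≤k k≤ 1≤L L≤)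

  vertical : ∀ {s p dir} → Claimed s p dir → PathsHaveShape n π s vert p dir (SignedSq s π)
  vertical {s} {p} {dir} c = pathsHaveShape n π s vert p dir (SignedSq s π)
    (LineRule-transfer (horizontalRule inverse-entrywise c) from-inverse to-inverse
      (SignedSq-transpose⁻¹ s _ _) (SignedSq-transpose s _ _))
    (SignedSq⇒Filled s {π})
    (λ {L} {_} {k} filled sq → let (s′ , sq′) = Filled⇒SignedSq {π} {k} {L} filled in
      SignedSq-row-unique {s′} {s} {π} sq′ sq)
    where
      to-inverse : ∀ {L k} → TypePt n π s vert p (k , L) → TypePt n τ s horiz p (L , k)
      to-inverse ((1≤k , k≤) , (1≤L , L≤) , t) = (1≤L , L≤) , (1≤k , k≤) , trans (sym (d-vert≡d-horiz-inverse s _ _ 1≤k k≤ 1≤L L≤)) t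
      from-inverse : ∀ {L k} → TypePt n τ s horiz p (L , k) → TypePt n π s vert p (k , L)
      from-inverse ((1≤L , L≤) , (1≤k , k≤) , t) = (1≤k , k≤) , (1≤L , L≤) , trans (d-vert≡d-horiz-inverse s _ _ 1≤k k≤ 1≤L L≤) t

theorem3p12 : (n : ℕ) (π : Word) → IsSignedPerm n π →
    (PathsHaveShape n π plus horiz 0 down (PosSq π)
      × PathsHaveShape n π plus horiz 1 up (PosSq π))
    × (PathsHaveShape n π plus vert 0 down (PosSq π)
      × PathsHaveShape n π plus vert 1 up (PosSq π))
    × (PathsHaveShape n π minus horiz 0 up (NegSq π)
      × PathsHaveShape n π minus horiz 1 down (NegSq π))
    × (PathsHaveShape n π minus vert 0 up (NegSq π)
      × PathsHaveShape n π minus vert 1 down (NegSq π))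
theorem3p12 n π P =
  (horizontal P plus-0  , horizontal P plus-1)  , (vertical P plus-0  , vertical P plus-1) ,
  (horizontal P minus-0 , horizontal P minus-1) , (vertical P minus-0 , vertical P minus-1)
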